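{- The field $\mathbb{Q}(\zeta_{20}+\zeta_{20}^{ -1})$ does not admit a universal ternary lattice.
   Context: $\zeta_{20}$ is a primitive 20th root of unity. For a totally real field $K$ with ring of integers $\mathcal{O}_K$ and set $\mathcal{O}_K^+$ of totally positive elements, a lattice over $K$ is a finitely generated torsion-free $\mathcal{O}_K$-module $L$ with $Q:L\to\mathcal{O}_K$ such that $Q(av)=a^2Q(v)$ and $B(u,v)=\frac12(Q(u+v)-Q(u)-Q(v))$ is bilinear; lattices are assumed positive definite ($Q(v)\in\mathcal{O}_K^+$ for $v\neq0$) and classical ($B(u,v)\in\mathcal{O}_K$). Ternary = rank 3; universal = every element of $\mathcal{O}_K^+$ equals $Q(v)$ for some $v\in L$. -}

module Defs where

open import Data.Bool using (Bool; true; false)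
open import Data.Integer using (ℤ; +_; -_; _+_; _-_; _*_; _<_; _≤_; 0ℤ)
open import Data.Product using (Σ; _×_; _,_)
open import Data.Sum using (_⊎_)
open import Relation.Nullary using (¬_)
open import Relation.Binary.PropositionalEquality using (_≡_)

-- The ring of integers O_K of K = Q(ζ₂₀ + ζ₂₀⁻¹).
-- α := ζ₂₀ + ζ₂₀⁻¹ has minimal polynomial x⁴ - 5x² + 5, and
-- O_K = ℤ[α] with ℤ-basis 1, α, α², α³.  An element is stored by its
-- (unique) coordinates  a0 + a1 α + a2 α² + a3 α³.

record OK : Set where
  constructor ok
  field
    a0 a1 a2 a3 : ℤ

open OK public

infixl 6 _⊕_
infixl 7 _⊗_

_⊕_ : OK → OK → OK
ok x0 x1 x2 x3 ⊕ ok y0 y1 y2 y3 = ok (x0 + y0) (x1 + y1) (x2 + y2) (x3 + y3)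

-- multiplication, reducing with α⁴ = 5α² - 5, α⁵ = 5α³ - 5α, α⁶ = 20α² - 25
_⊗_ : OK → OK → OK
ok x0 x1 x2 x3 ⊗ ok y0 y1 y2 y3 =
  ok (c0 - + 5 * c4 - + 25 * c6)
     (c1 - + 5 * c5)
     (c2 + + 5 * c4 + + 20 * c6)
     (c3 + + 5 * c5)
  where
  c0 = x0 * y0
  c1 = x0 * y1 + x1 * y0
  c2 = x0 * y2 + x1 * y1 + x2 * y0
  c3 = x0 * y3 + x1 * y2 + x2 * y1 + x3 * y0
  c4 = x1 * y3 + x2 * y2 + x3 * y1
  c5 = x2 * y3 + x3 * y2
  c6 = x3 * y3

𝟘 : OK
𝟘 = ok 0ℤ 0ℤ 0ℤ 0ℤ

-- Exact sign computations for real numbers of the form p + q√5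
-- (p q ∈ ℤ, √5 the positive square root).

record Z√5 : Set where
  constructor ⟨_,_⟩√5
  field
    re ir : ℤ

open Z√5 public

_⊕₅_ : Z√5 → Z√5 → Z√5
⟨ p , q ⟩√5 ⊕₅ ⟨ r , s ⟩√5 = ⟨ p + r , q + s ⟩√5

_⊖₅_ : Z√5 → Z√5 → Z√5
⟨ p , q ⟩√5 ⊖₅ ⟨ r , s ⟩√5 = ⟨ p - r , q - s ⟩√5

_⊗₅_ : Z√5 → Z√5 → Z√5
⟨ p , q ⟩√5 ⊗₅ ⟨ r , s ⟩√5 = ⟨ p * r + + 5 * (q * s) , p * s + q * r ⟩√5

Pos₅ : Z√5 → Set
Pos₅ ⟨ p , q ⟩√5 =
    (0ℤ ≤ p × 0ℤ ≤ q × ¬ (p ≡ 0ℤ × q ≡ 0ℤ))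
  ⊎ (0ℤ < p × q < 0ℤ × + 5 * (q * q) < p * p)
  ⊎ (p < 0ℤ × 0ℤ < q × p * p < + 5 * (q * q))

NonNeg₅ : Z√5 → Set
NonNeg₅ x = Pos₅ x ⊎ (re x ≡ 0ℤ × ir x ≡ 0ℤ)

sg : Bool → ℤ → ℤ
sg true  x = x
sg false x = - x

sg₅ : Bool → Z√5 → Z√5
sg₅ b ⟨ p , q ⟩√5 = ⟨ sg b p , sg b q ⟩√5

-- The four real embeddings of K.  The roots of x⁴ - 5x² + 5 are
--   r(ε,δ) = δ · √((5 + ε√5)/2),   ε, δ ∈ {±1}.
-- For a = a0 + a1 α + a2 α² + a3 α³ and s = r² = (5 + ε√5)/2 we have
--   2 σ(a) = C + δ √s · D,   C = 2a0 + a2(5 + ε√5),  D = 2a1 + a3(5 + ε√5),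
-- with C, D of the form p + q√5.  Since √s > 0, σ(a) > 0 iff
--   (C > 0 and (δD ≥ 0 or 2C² > (5+ε√5) D²))
--   or (C ≤ 0 and δD > 0 and (5+ε√5) D² > 2C²).

EmbPos : Bool → Bool → OK → Set
EmbPos ε δ (ok x0 x1 x2 x3) =
    (Pos₅ C × (NonNeg₅ E ⊎ Pos₅ ((two ⊗₅ (C ⊗₅ C)) ⊖₅ (S ⊗₅ (D ⊗₅ D)))))
  ⊎ (¬ Pos₅ C × Pos₅ E × Pos₅ ((S ⊗₅ (D ⊗₅ D)) ⊖₅ (two ⊗₅ (C ⊗₅ C))))
  where
  two = ⟨ + 2 , 0ℤ ⟩√5
  S   = ⟨ + 5 , sg ε (+ 1) ⟩√5
  C   = ⟨ + 2 * x0 + + 5 * x2 , sg ε x2 ⟩√5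
  D   = ⟨ + 2 * x1 + + 5 * x3 , sg ε x3 ⟩√5
  E   = sg₅ δ D

TotPos : OK → Set
TotPos a = (ε δ : Bool) → EmbPos ε δ a

-- Since O_K has class number 1,
-- a rank-3 finitely generated torsion-free O_K-module is free, L = O_K³,
-- and Q(v) = B(v,v) with B the O_K-bilinear form whose (symmetric) Gram
-- matrix (B(eᵢ,eⱼ)) has entries in O_K (classicality).

record Gram : Set where
  field
    g11 g22 g33 g12 g13 g23 : OK

open Gram public

record Vec3 : Set where
  constructor v3
  field
    x y z : OK

open Vec3 public

𝟘₃ : Vec3
𝟘₃ = v3 𝟘 𝟘 𝟘

B : Gram → Vec3 → Vec3 → OK
B G (v3 u1 u2 u3) (v3 w1 w2 w3) =
    u1 ⊗ (g11 G ⊗ w1 ⊕ g12 G ⊗ w2 ⊕ g13 G ⊗ w3)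
  ⊕ u2 ⊗ (g12 G ⊗ w1 ⊕ g22 G ⊗ w2 ⊕ g23 G ⊗ w3)
  ⊕ u3 ⊗ (g13 G ⊗ w1 ⊕ g23 G ⊗ w2 ⊕ g33 G ⊗ w3)

Q : Gram → Vec3 → OK
Q G v = B G v v

PositiveDefinite : Gram → Set
PositiveDefinite G = (v : Vec3) → ¬ (v ≡ 𝟘₃) → TotPos (Q G v)

Universal : Gram → Set
Universal G = (a : OK) → TotPos a → Σ Vec3 (λ v → Q G v ≡ a)

{-# OPTIONS --safe #-}
module Submission where

-- Write α = ζ₂₀ + ζ₂₀⁻¹, u = 2 + α, π = α + α² and τ = 2α + α² − α³; all four
-- are totally positive, u is a unit and π has norm 5.  A universal ternary
-- lattice L represents 1, u, π and τ.  If e has norm 1 and w₀ norm u, then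
-- w₀ − B(e,w₀) e has norm u − x² (x = B(e,w₀)), which must be zero or totally
-- positive.  The half-trace P(a) = Tr(a)/2 is positive on totally positive
-- elements, so P(x²) ≤ P(u) = 4, which leaves finitely many x; checking them
-- all gives x = 0.  In the same way L contains pairwise orthogonal vectors
-- e, w, z of norms 1, u, π.  As L has rank three, a vector v of norm τ then
-- satisfies πτ = πx² + πuy² + b² for some x, y, b in O_K.  Now
-- P(πx²) + P(πuy²) + P(b²) = P(πτ) = 10 bounds all three terms, and an
-- exhaustive search shows that this equation has no solution.

open import Algebra.Bundles using (CommutativeRing)
open import Algebra.Bundles.Raw using (RawRing)
import Algebra.Properties.Ring as RingProperties
import Algebra.Solver.Ring as RingSolver
open import Algebra.Solver.Ring.AlmostCommutativeRing
  using (_-Raw-AlmostCommutative⟶_; fromCommutativeRing)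
open import Data.Empty using (⊥; ⊥-elim)
open import Data.Fin using (#_)
open import Data.Integer using (ℤ; 0ℤ; 1ℤ; +-*-rawRing)
import Data.Integer.Properties as ℤ
open import Data.Maybe as Maybe using (Maybe)
open import Data.Product using (Σ; _×_; _,_; proj₁; proj₂)
open import Data.Vec using (Vec; []; _∷_; _++_)
open import Relation.Nullary using (¬_; Dec; yes; no)
open import Relation.Nullary.Decidable using (dec⇒maybe)
import Relation.Binary.PropositionalEquality as ≡
import Relation.Binary.Reasoning.Setoid as ≈-Reasoning

-- Vectors, cross products and quadratic forms in rank three

record Vector {a} (A : Set a) : Set a where
  constructor ⟨_,_,_⟩
  field
    x₁ x₂ x₃ : A

open Vector public

record SymmetricMatrix {a} (A : Set a) : Set a where
  constructor symmetric
  field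
    m₁₁ m₂₂ m₃₃ m₁₂ m₁₃ m₂₃ : A

-- Stated over a raw ring so that the same formulas apply to ring elements and
-- to the ring solver's polynomials.
module VectorOperations {a ℓ} (R : RawRing a ℓ) where

  open RawRing R using (_+_; _*_; -_) renaming (Carrier to A)

  infixl 6 _+ᵥ_ _-ᵥ_ _−_
  infixr 7 _•_
  infix 8 _∙_ _⨯_ _⋆_

  private
    _−_ : A → A → A
    x − y = x + - y

  _+ᵥ_ _-ᵥ_ _⨯_ : Vector A → Vector A → Vector A
  ⟨ a₁ , a₂ , a₃ ⟩ +ᵥ ⟨ b₁ , b₂ , b₃ ⟩ = ⟨ a₁ + b₁ , a₂ + b₂ , a₃ + b₃ ⟩
  ⟨ a₁ , a₂ , a₃ ⟩ -ᵥ ⟨ b₁ , b₂ , b₃ ⟩ = ⟨ a₁ − b₁ , a₂ − b₂ , a₃ − b₃ ⟩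
  ⟨ a₁ , a₂ , a₃ ⟩ ⨯ ⟨ b₁ , b₂ , b₃ ⟩ = ⟨ a₂ * b₃ − a₃ * b₂ , a₃ * b₁ − a₁ * b₃ , a₁ * b₂ − a₂ * b₁ ⟩

  _•_ : A → Vector A → Vector A
  s • ⟨ a₁ , a₂ , a₃ ⟩ = ⟨ s * a₁ , s * a₂ , s * a₃ ⟩

  _∙_ : Vector A → Vector A → A
  ⟨ a₁ , a₂ , a₃ ⟩ ∙ ⟨ b₁ , b₂ , b₃ ⟩ = a₁ * b₁ + a₂ * b₂ + a₃ * b₃

  _⋆_ : SymmetricMatrix A → Vector A → Vector A
  symmetric g₁₁ g₂₂ g₃₃ g₁₂ g₁₃ g₂₃ ⋆ v =
    ⟨ ⟨ g₁₁ , g₁₂ , g₁₃ ⟩ ∙ v , ⟨ g₁₂ , g₂₂ , g₂₃ ⟩ ∙ v , ⟨ g₁₃ , g₂₃ , g₃₃ ⟩ ∙ v ⟩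

  [_,_,_] : Vector A → Vector A → Vector A → A
  [ a , b , c ] = a ∙ (b ⨯ c)

-- The homomorphism from ℤ (which every commutative ring has) lets the ring
-- solver compute with integer coefficients.
module QuadraticSpace {c ℓ} (R : CommutativeRing c ℓ)
  (ℤ⟶R : +-*-rawRing -Raw-AlmostCommutative⟶ fromCommutativeRing R) where

  open CommutativeRing R
  open VectorOperations rawRing public
  open ≈-Reasoning setoid
  open RingProperties ring using (-0#≈0#)
  open import Algebra.Properties.Group +-group using (x∙y⁻¹≈ε⇒x≈y)

  infix 4 _≈ᵥ_
  _≈ᵥ_ : Vector Carrier → Vector Carrier → Set ℓ
  u ≈ᵥ v = x₁ u ≈ x₁ v × x₂ u ≈ x₂ v × x₃ u ≈ x₃ v

  ≈ᵥ-trans : ∀ {u v w} → u ≈ᵥ v → v ≈ᵥ w → u ≈ᵥ w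
  ≈ᵥ-trans (p₁ , p₂ , p₃) (q₁ , q₂ , q₃) = trans p₁ q₁ , trans p₂ q₂ , trans p₃ q₃

  ∙-congʳ : ∀ {a b b′} → b ≈ᵥ b′ → a ∙ b ≈ a ∙ b′
  ∙-congʳ (p₁ , p₂ , p₃) = +-cong (+-cong (*-congˡ p₁) (*-congˡ p₂)) (*-congˡ p₃)

  -- Identities in the entries of a symmetric matrix, four vectors and a scalar
  -- are proved by evaluating the same formulas at the solver variables 𝐆, 𝐚, …, 𝐫.
  private
    coefficients≟ : (m n : ℤ) → Maybe (_-Raw-AlmostCommutative⟶_.⟦_⟧ ℤ⟶R m ≈ _-Raw-AlmostCommutative⟶_.⟦_⟧ ℤ⟶R n)
    coefficients≟ m n = Maybe.map (λ { ≡.refl → refl }) (dec⇒maybe (m ℤ.≟ n))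

    module S = RingSolver +-*-rawRing (fromCommutativeRing R) ℤ⟶R coefficients≟
    open S using (Polynomial; var; prove; solve; _:=_; _:+_; _:*_; _:-_)

    polynomials : RawRing _ _
    polynomials = record
      { Carrier = Polynomial 19 ; _≈_ = ≡._≡_ ; _+_ = _:+_ ; _*_ = _:*_ ; -_ = S.:-_
      ; 0# = S.con 0ℤ ; 1# = S.con 1ℤ }

    module ᴾ = VectorOperations polynomials

    ⟦_⟧ᵥ : Vector (Polynomial 19) → Vec Carrier 19 → Vector Carrier
    ⟦ ⟨ p₁ , p₂ , p₃ ⟩ ⟧ᵥ ρ = ⟨ S.⟦ p₁ ⟧ ρ , S.⟦ p₂ ⟧ ρ , S.⟦ p₃ ⟧ ρ ⟩

    by-components : ∀ ρ (P Q : Vector (Polynomial 19)) →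
      S.⟦ x₁ P ⟧↓ ρ ≈ S.⟦ x₁ Q ⟧↓ ρ → S.⟦ x₂ P ⟧↓ ρ ≈ S.⟦ x₂ Q ⟧↓ ρ → S.⟦ x₃ P ⟧↓ ρ ≈ S.⟦ x₃ Q ⟧↓ ρ →
      ⟦ P ⟧ᵥ ρ ≈ᵥ ⟦ Q ⟧ᵥ ρ
    by-components ρ P Q e₁ e₂ e₃ = prove ρ (x₁ P) (x₁ Q) e₁ , prove ρ (x₂ P) (x₂ Q) e₂ , prove ρ (x₃ P) (x₃ Q) e₃

    𝐆 : SymmetricMatrix (Polynomial 19)
    𝐆 = symmetric (var (# 0)) (var (# 1)) (var (# 2)) (var (# 3)) (var (# 4)) (var (# 5))

    𝐚 𝐛 𝐜 𝐝 : Vector (Polynomial 19)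
    𝐚 = ⟨ var (# 6) , var (# 7) , var (# 8) ⟩
    𝐛 = ⟨ var (# 9) , var (# 10) , var (# 11) ⟩
    𝐜 = ⟨ var (# 12) , var (# 13) , var (# 14) ⟩
    𝐝 = ⟨ var (# 15) , var (# 16) , var (# 17) ⟩

    𝐫 : Polynomial 19
    𝐫 = var (# 18)

    environment : SymmetricMatrix Carrier → (a b c d : Vector Carrier) → Carrier → Vec Carrier 19
    environment (symmetric g₁₁ g₂₂ g₃₃ g₁₂ g₁₃ g₂₃) ⟨ a₁ , a₂ , a₃ ⟩ ⟨ b₁ , b₂ , b₃ ⟩ ⟨ c₁ , c₂ , c₃ ⟩ ⟨ d₁ , d₂ , d₃ ⟩ r =
      g₁₁ ∷ g₂₂ ∷ g₃₃ ∷ g₁₂ ∷ g₁₃ ∷ g₂₃ ∷ a₁ ∷ a₂ ∷ a₃ ∷ b₁ ∷ b₂ ∷ b₃ ∷ c₁ ∷ c₂ ∷ c₃ ∷ d₁ ∷ d₂ ∷ d₃ ∷ r ∷ []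

    𝟎 : SymmetricMatrix Carrier
    𝟎 = symmetric 0# 0# 0# 0# 0# 0#

    ⟪_,_⟫ᴾ : Vector (Polynomial 19) → Vector (Polynomial 19) → Polynomial 19
    ⟪ u , v ⟫ᴾ = u ᴾ.∙ (𝐆 ᴾ.⋆ v)

    x-y*0≈x : ∀ x y {z} → z ≈ 0# → x - y * z ≈ x
    x-y*0≈x x y {z} z≈0 = begin
      x - y * z  ≈⟨ +-congˡ (-‿cong (trans (*-congˡ z≈0) (zeroʳ y))) ⟩
      x - 0#     ≈⟨ +-congˡ -0#≈0# ⟩
      x + 0#     ≈⟨ +-identityʳ x ⟩
      x          ∎

    vanish : ∀ {s t} p q r → s ≈ 0# → t ≈ 0# → s * p + t * q + r ≈ r
    vanish {s} {t} p q r s≈0 t≈0 = begin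
      s * p + t * q + r    ≈⟨ +-congʳ (+-cong (*-congʳ s≈0) (*-congʳ t≈0)) ⟩
      0# * p + 0# * q + r  ≈⟨ +-congʳ (+-cong (zeroˡ p) (zeroˡ q)) ⟩
      0# + 0# + r          ≈⟨ +-congʳ (+-identityˡ 0#) ⟩
      0# + r               ≈⟨ +-identityˡ r ⟩
      r                    ∎

  binet-cauchy : ∀ a b c d → (a ⨯ b) ∙ (c ⨯ d) ≈ (a ∙ c) * (b ∙ d) - (a ∙ d) * (b ∙ c)
  binet-cauchy a b c d = prove (environment 𝟎 a b c d 0#)
    ((𝐚 ᴾ.⨯ 𝐛) ᴾ.∙ (𝐜 ᴾ.⨯ 𝐝)) ((𝐚 ᴾ.∙ 𝐜) :* (𝐛 ᴾ.∙ 𝐝) :- (𝐚 ᴾ.∙ 𝐝) :* (𝐛 ᴾ.∙ 𝐜)) refl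

  cramer : ∀ a b c y →
    [ a , b , c ] • y ≈ᵥ (a ∙ y) • (b ⨯ c) +ᵥ (b ∙ y) • (c ⨯ a) +ᵥ (c ∙ y) • (a ⨯ b)
  cramer a b c y = by-components (environment 𝟎 a b c y 0#) (ᴾ.[ 𝐚 , 𝐛 , 𝐜 ] ᴾ.• 𝐝)
    ((𝐚 ᴾ.∙ 𝐝) ᴾ.• (𝐛 ᴾ.⨯ 𝐜) ᴾ.+ᵥ (𝐛 ᴾ.∙ 𝐝) ᴾ.• (𝐜 ᴾ.⨯ 𝐚) ᴾ.+ᵥ (𝐜 ᴾ.∙ 𝐝) ᴾ.• (𝐚 ᴾ.⨯ 𝐛))
    refl refl refl

  ∙-•ʳ : ∀ a s b → a ∙ (s • b) ≈ s * (a ∙ b)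
  ∙-•ʳ a s b = prove (environment 𝟎 a b a a s) (𝐚 ᴾ.∙ (𝐫 ᴾ.• 𝐛)) (𝐫 :* (𝐚 ᴾ.∙ 𝐛)) refl

  module Form (G : SymmetricMatrix Carrier) where

    ⟪_,_⟫ : Vector Carrier → Vector Carrier → Carrier
    ⟪ u , v ⟫ = u ∙ (G ⋆ v)

    ‖_‖ : Vector Carrier → Carrier
    ‖ v ‖ = ⟪ v , v ⟫

    ⟪⟫-sym : ∀ u v → ⟪ u , v ⟫ ≈ ⟪ v , u ⟫
    ⟪⟫-sym u v = prove (environment G u v u u 0#) ⟪ 𝐚 , 𝐛 ⟫ᴾ ⟪ 𝐛 , 𝐚 ⟫ᴾ refl

    ⋆-∙ : ∀ u v → (G ⋆ u) ∙ v ≈ ⟪ v , u ⟫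
    ⋆-∙ u v = prove (environment G u v u u 0#) ((𝐆 ᴾ.⋆ 𝐚) ᴾ.∙ 𝐛) ⟪ 𝐛 , 𝐚 ⟫ᴾ refl

    ⟪⟫-•ʳ : ∀ u s v → ⟪ u , s • v ⟫ ≈ s * ⟪ u , v ⟫
    ⟪⟫-•ʳ u s v = prove (environment G u v u u s) ⟪ 𝐚 , 𝐫 ᴾ.• 𝐛 ⟫ᴾ (𝐫 :* ⟪ 𝐚 , 𝐛 ⟫ᴾ) refl

    ⟪⟫-linearʳ : ∀ u v q e → ⟪ u , v -ᵥ q • e ⟫ ≈ ⟪ u , v ⟫ - q * ⟪ u , e ⟫
    ⟪⟫-linearʳ u v q e = prove (environment G u v e u q) ⟪ 𝐚 , 𝐛 ᴾ.-ᵥ 𝐫 ᴾ.• 𝐜 ⟫ᴾ (⟪ 𝐚 , 𝐛 ⟫ᴾ :- 𝐫 :* ⟪ 𝐚 , 𝐜 ⟫ᴾ) refl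

    ‖•‖ : ∀ s v → ‖ s • v ‖ ≈ s * s * ‖ v ‖
    ‖•‖ s v = prove (environment G v v v v s) ⟪ 𝐫 ᴾ.• 𝐚 , 𝐫 ᴾ.• 𝐚 ⟫ᴾ (𝐫 :* 𝐫 :* ⟪ 𝐚 , 𝐚 ⟫ᴾ) refl

    ‖-ᵥ•‖ : ∀ v q e → ‖ v -ᵥ q • e ‖ ≈ ‖ v ‖ - q * (⟪ v , e ⟫ + ⟪ e , v ⟫) + q * q * ‖ e ‖
    ‖-ᵥ•‖ v q e = prove (environment G v e v v q) ⟪ 𝐚 ᴾ.-ᵥ 𝐫 ᴾ.• 𝐛 , 𝐚 ᴾ.-ᵥ 𝐫 ᴾ.• 𝐛 ⟫ᴾ
      (⟪ 𝐚 , 𝐚 ⟫ᴾ :- 𝐫 :* (⟪ 𝐚 , 𝐛 ⟫ᴾ :+ ⟪ 𝐛 , 𝐚 ⟫ᴾ) :+ 𝐫 :* 𝐫 :* ⟪ 𝐛 , 𝐛 ⟫ᴾ) refl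

    ⟪⟫-•ˡ : ∀ s u v → ⟪ s • u , v ⟫ ≈ s * ⟪ u , v ⟫
    ⟪⟫-•ˡ s u v = prove (environment G u v u u s) ⟪ 𝐫 ᴾ.• 𝐚 , 𝐛 ⟫ᴾ (𝐫 :* ⟪ 𝐚 , 𝐛 ⟫ᴾ) refl

    module _ {e v q} (q‖e‖≈⟪e,v⟫ : q * ‖ e ‖ ≈ ⟪ e , v ⟫) where

      projection-⟂ : ⟪ e , v -ᵥ q • e ⟫ ≈ 0#
      projection-⟂ = begin
        ⟪ e , v -ᵥ q • e ⟫     ≈⟨ ⟪⟫-linearʳ e v q e ⟩
        ⟪ e , v ⟫ - q * ‖ e ‖  ≈⟨ +-congˡ (-‿cong q‖e‖≈⟪e,v⟫) ⟩
        ⟪ e , v ⟫ - ⟪ e , v ⟫  ≈⟨ -‿inverseʳ ⟪ e , v ⟫ ⟩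
        0#                     ∎

      projection-‖‖ : ‖ v -ᵥ q • e ‖ ≈ ‖ v ‖ - q * q * ‖ e ‖
      projection-‖‖ = begin
        ‖ v -ᵥ q • e ‖                                       ≈⟨ ‖-ᵥ•‖ v q e ⟩
        ‖ v ‖ - q * (⟪ v , e ⟫ + ⟪ e , v ⟫) + q * q * ‖ e ‖  ≈⟨ +-congʳ (+-congˡ (-‿cong (*-congˡ (+-cong ⟪v,e⟫≈ ⟪e,v⟫≈)))) ⟩
        ‖ v ‖ - q * (q * ‖ e ‖ + q * ‖ e ‖) + q * q * ‖ e ‖  ≈⟨ collect (‖ v ‖) q (‖ e ‖) ⟩
        ‖ v ‖ - q * q * ‖ e ‖                                ∎
        where
        ⟪e,v⟫≈ : ⟪ e , v ⟫ ≈ q * ‖ e ‖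
        ⟪e,v⟫≈ = sym q‖e‖≈⟪e,v⟫
        ⟪v,e⟫≈ : ⟪ v , e ⟫ ≈ q * ‖ e ‖
        ⟪v,e⟫≈ = trans (⟪⟫-sym v e) ⟪e,v⟫≈
        collect : ∀ V q n → V - q * (q * n + q * n) + q * q * n ≈ V - q * q * n
        collect = solve 3 (λ V q n → V :- q :* (q :* n :+ q :* n) :+ q :* q :* n := V :- q :* q :* n) refl

    projection-preserves-⟂ : ∀ {f e v} q → ⟪ f , e ⟫ ≈ 0# → ⟪ f , v -ᵥ q • e ⟫ ≈ ⟪ f , v ⟫
    projection-preserves-⟂ {f} {e} {v} q f⟂e = trans (⟪⟫-linearʳ f v q e) (x-y*0≈x ⟪ f , v ⟫ q f⟂e)

    -- By Cramer's rule, [ a , b , k ]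
    -- times a vector orthogonal to e and w is a multiple of n = a ⨯ b;
    -- comparing v with z and using (e ⨯ w) ∙ n = ‖ e ‖ * ‖ w ‖ (Binet–Cauchy)
    -- gives rank-three.
    module _ {e w z} (e⟂w : ⟪ e , w ⟫ ≈ 0#) (e⟂z : ⟪ e , z ⟫ ≈ 0#) (w⟂z : ⟪ w , z ⟫ ≈ 0#) where

      private
        a b k n m : Vector Carrier
        a = G ⋆ e
        b = G ⋆ w
        k = G ⋆ z
        n = a ⨯ b
        m = e ⨯ w

        d : Carrier
        d = [ a , b , k ]

        parallel : ∀ {y} → ⟪ e , y ⟫ ≈ 0# → ⟪ w , y ⟫ ≈ 0# → d • y ≈ᵥ (k ∙ y) • n
        parallel {y} e⟂y w⟂y = ≈ᵥ-trans (cramer a b k y) (drop , drop , drop)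
          where
          a∙y≈0 : a ∙ y ≈ 0#
          a∙y≈0 = trans (⋆-∙ e y) (trans (⟪⟫-sym y e) e⟂y)
          b∙y≈0 : b ∙ y ≈ 0#
          b∙y≈0 = trans (⋆-∙ w y) (trans (⟪⟫-sym y w) w⟂y)
          drop : ∀ {p q r} → (a ∙ y) * p + (b ∙ y) * q + r ≈ r
          drop {p} {q} {r} = vanish p q r a∙y≈0 b∙y≈0

        m∙n≈ : m ∙ n ≈ ‖ e ‖ * ‖ w ‖
        m∙n≈ = trans (binet-cauchy e w a b) (x-y*0≈x (‖ e ‖ * ‖ w ‖) ⟪ e , w ⟫ (trans (⟪⟫-sym w e) e⟂w))

        d[m∙z]≈ : d * (m ∙ z) ≈ ‖ e ‖ * ‖ w ‖ * ‖ z ‖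
        d[m∙z]≈ = begin
          d * (m ∙ z)            ≈⟨ ∙-•ʳ m d z ⟨
          m ∙ (d • z)            ≈⟨ ∙-congʳ (parallel e⟂z w⟂z) ⟩
          m ∙ ((k ∙ z) • n)      ≈⟨ ∙-•ʳ m (k ∙ z) n ⟩
          (k ∙ z) * (m ∙ n)      ≈⟨ *-cong (⋆-∙ z z) m∙n≈ ⟩
          ‖ z ‖ * (‖ e ‖ * ‖ w ‖) ≈⟨ *-comm (‖ z ‖) _ ⟩
          ‖ e ‖ * ‖ w ‖ * ‖ z ‖   ∎

      rank-three : ∀ {v} → ⟪ e , v ⟫ ≈ 0# → ⟪ w , v ⟫ ≈ 0# → ⟪ z , v ⟫ ≈ 0# →
        (‖ e ‖ * ‖ w ‖ * ‖ z ‖) • v ≈ᵥ ⟨ 0# , 0# , 0# ⟩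
      rank-three {v} e⟂v w⟂v z⟂v = killed (proj₁ dv≈0) , killed (proj₁ (proj₂ dv≈0)) , killed (proj₂ (proj₂ dv≈0))
        where
        k∙v≈0 : k ∙ v ≈ 0#
        k∙v≈0 = trans (⋆-∙ z v) (trans (⟪⟫-sym v z) z⟂v)
        dv≈0 : d • v ≈ᵥ ⟨ 0# , 0# , 0# ⟩
        dv≈0 = ≈ᵥ-trans (parallel e⟂v w⟂v) (zeroed , zeroed , zeroed)
          where
          zeroed : ∀ {p} → (k ∙ v) * p ≈ 0#
          zeroed {p} = trans (*-congʳ k∙v≈0) (zeroˡ p)
        regroup : ∀ D M x → D * M * x ≈ M * (D * x)
        regroup = solve 3 (λ D M x → D :* M :* x := M :* (D :* x)) refl
        killed : ∀ {x} → d * x ≈ 0# → ‖ e ‖ * ‖ w ‖ * ‖ z ‖ * x ≈ 0#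
        killed {x} dx≈0 = begin
          ‖ e ‖ * ‖ w ‖ * ‖ z ‖ * x  ≈⟨ *-congʳ d[m∙z]≈ ⟨
          d * (m ∙ z) * x          ≈⟨ regroup d (m ∙ z) x ⟩
          (m ∙ z) * (d * x)        ≈⟨ *-congˡ dx≈0 ⟩
          (m ∙ z) * 0#             ≈⟨ zeroʳ (m ∙ z) ⟩
          0#                       ∎

      rank-three-norm : ∀ {v} → ⟪ e , v ⟫ ≈ 0# → ⟪ w , v ⟫ ≈ 0# → ⟪ z , v ⟫ ≈ 0# →
        ‖ e ‖ * ‖ w ‖ * ‖ z ‖ * ‖ v ‖ ≈ 0#
      rank-three-norm {v} e⟂v w⟂v z⟂v = begin
        K * ‖ v ‖                   ≈⟨ ⟪⟫-•ˡ K v v ⟨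
        ⟪ K • v , v ⟫               ≈⟨ vanish (x₁ (G ⋆ v)) (x₂ (G ⋆ v)) (K * x₃ v * x₃ (G ⋆ v)) K₁≈0 K₂≈0 ⟩
        K * x₃ v * x₃ (G ⋆ v)       ≈⟨ *-congʳ K₃≈0 ⟩
        0# * x₃ (G ⋆ v)             ≈⟨ zeroˡ (x₃ (G ⋆ v)) ⟩
        0#                          ∎
        where
        K : Carrier
        K = ‖ e ‖ * ‖ w ‖ * ‖ z ‖
        Kv≈0 : K • v ≈ᵥ ⟨ 0# , 0# , 0# ⟩
        Kv≈0 = rank-three e⟂v w⟂v z⟂v
        K₁≈0 : K * x₁ v ≈ 0#
        K₁≈0 = proj₁ Kv≈0
        K₂≈0 : K * x₂ v ≈ 0#
        K₂≈0 = proj₁ (proj₂ Kv≈0)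
        K₃≈0 : K * x₃ v ≈ 0#
        K₃≈0 = proj₂ (proj₂ Kv≈0)

    module UnitCoordinate (e : Vector Carrier) (‖e‖≈1 : ‖ e ‖ ≈ 1#) (v : Vector Carrier) where

      x : Carrier
      x = ⟪ e , v ⟫

      residual : Vector Carrier
      residual = v -ᵥ x • e

      private
        x‖e‖≈⟪e,v⟫ : x * ‖ e ‖ ≈ ⟪ e , v ⟫
        x‖e‖≈⟪e,v⟫ = trans (*-congˡ ‖e‖≈1) (*-identityʳ x)

      residual-⟂ : ⟪ e , residual ⟫ ≈ 0#
      residual-⟂ = projection-⟂ x‖e‖≈⟪e,v⟫

      residual-norm : ‖ residual ‖ ≈ ‖ v ‖ - x * x
      residual-norm = trans (projection-‖‖ x‖e‖≈⟪e,v⟫) (+-congˡ (-‿cong (trans (*-congˡ ‖e‖≈1) (*-identityʳ (x * x)))))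

    module Coordinates (e w : Vector Carrier) (s : Carrier)
      (‖e‖≈1 : ‖ e ‖ ≈ 1#) (s‖w‖≈1 : s * ‖ w ‖ ≈ 1#) (e⟂w : ⟪ e , w ⟫ ≈ 0#) (v : Vector Carrier) where

      open UnitCoordinate e ‖e‖≈1 v public using (x)
      private
        module E = UnitCoordinate e ‖e‖≈1 v

      y : Carrier
      y = s * ⟪ w , v ⟫

      residual : Vector Carrier
      residual = E.residual -ᵥ y • w

      private
        y‖w‖≈⟪w,v-xe⟫ : y * ‖ w ‖ ≈ ⟪ w , E.residual ⟫
        y‖w‖≈⟪w,v-xe⟫ = begin
          s * ⟪ w , v ⟫ * ‖ w ‖  ≈⟨ swap s ⟪ w , v ⟫ (‖ w ‖) ⟩
          s * ‖ w ‖ * ⟪ w , v ⟫  ≈⟨ *-congʳ s‖w‖≈1 ⟩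
          1# * ⟪ w , v ⟫         ≈⟨ *-identityˡ ⟪ w , v ⟫ ⟩
          ⟪ w , v ⟫              ≈⟨ projection-preserves-⟂ x (trans (⟪⟫-sym w e) e⟂w) ⟨
          ⟪ w , E.residual ⟫     ∎
          where
          swap : ∀ s B W → s * B * W ≈ s * W * B
          swap = solve 3 (λ s B W → s :* B :* W := s :* W :* B) refl

      residual-⟂e : ⟪ e , residual ⟫ ≈ 0#
      residual-⟂e = trans (projection-preserves-⟂ y e⟂w) E.residual-⟂

      residual-⟂w : ⟪ w , residual ⟫ ≈ 0#
      residual-⟂w = projection-⟂ y‖w‖≈⟪w,v-xe⟫

      residual-norm : ‖ residual ‖ ≈ ‖ v ‖ - (x * x + ‖ w ‖ * (y * y))
      residual-norm = begin
        ‖ residual ‖                       ≈⟨ projection-‖‖ y‖w‖≈⟪w,v-xe⟫ ⟩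
        ‖ E.residual ‖ - y * y * ‖ w ‖     ≈⟨ +-congʳ E.residual-norm ⟩
        ‖ v ‖ - x * x - y * y * ‖ w ‖      ≈⟨ regroup (‖ v ‖) (x * x) (y * y) (‖ w ‖) ⟩
        ‖ v ‖ - (x * x + ‖ w ‖ * (y * y))  ∎
        where
        regroup : ∀ V X Y W → V - X - Y * W ≈ V - (X + W * Y)
        regroup = solve 4 (λ V X Y W → V :- X :- Y :* W := V :- (X :+ W :* Y)) refl

      module _ (z : Vector Carrier) (e⟂z : ⟪ e , z ⟫ ≈ 0#) (w⟂z : ⟪ w , z ⟫ ≈ 0#) where

        b : Carrier
        b = ⟪ z , residual ⟫

        -- ‖ z ‖ • residual -ᵥ b • z is orthogonal to e, w and z, so its norm is
        -- annihilated by rank-three-norm.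
        norm-in-coordinates : (∀ {r} → ‖ e ‖ * ‖ w ‖ * ‖ z ‖ * ‖ z ‖ * r ≈ 0# → r ≈ 0#) →
          ‖ z ‖ * ‖ v ‖ ≈ ‖ z ‖ * (x * x) + ‖ z ‖ * ‖ w ‖ * (y * y) + b * b
        norm-in-coordinates cancel = x∙y⁻¹≈ε⇒x≈y _ _ (cancel (begin
          ‖ e ‖ * ‖ w ‖ * ‖ z ‖ * ‖ z ‖ * (‖ z ‖ * ‖ v ‖ - (‖ z ‖ * (x * x) + ‖ z ‖ * ‖ w ‖ * (y * y) + b * b))
            ≈⟨ rearrange (‖ e ‖) (‖ w ‖) (‖ z ‖) (‖ v ‖) (x * x) (y * y) (b * b) ⟨
          ‖ e ‖ * ‖ w ‖ * ‖ z ‖ * (‖ z ‖ * ‖ z ‖ * (‖ v ‖ - (x * x + ‖ w ‖ * (y * y))) - b * b * ‖ z ‖)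
            ≈⟨ *-congˡ (+-congʳ (*-congˡ residual-norm)) ⟨
          ‖ e ‖ * ‖ w ‖ * ‖ z ‖ * (‖ z ‖ * ‖ z ‖ * ‖ residual ‖ - b * b * ‖ z ‖)
            ≈⟨ *-congˡ ‖r‖ ⟨
          ‖ e ‖ * ‖ w ‖ * ‖ z ‖ * ‖ r ‖
            ≈⟨ rank-three-norm e⟂w e⟂z w⟂z r⟂e r⟂w r⟂z ⟩
          0# ∎))
          where
          n : Carrier
          n = ‖ z ‖
          r : Vector Carrier
          r = n • residual -ᵥ b • z
          b‖z‖≈ : b * ‖ z ‖ ≈ ⟪ z , n • residual ⟫
          b‖z‖≈ = trans (*-comm b n) (sym (⟪⟫-•ʳ z n residual))
          scaled-⟂ : ∀ {f} → ⟪ f , z ⟫ ≈ 0# → ⟪ f , residual ⟫ ≈ 0# → ⟪ f , r ⟫ ≈ 0#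
          scaled-⟂ {f} f⟂z f⟂res = begin
            ⟪ f , r ⟫                ≈⟨ projection-preserves-⟂ b f⟂z ⟩
            ⟪ f , n • residual ⟫     ≈⟨ ⟪⟫-•ʳ f n residual ⟩
            n * ⟪ f , residual ⟫     ≈⟨ *-congˡ f⟂res ⟩
            n * 0#                   ≈⟨ zeroʳ n ⟩
            0#                       ∎
          r⟂e : ⟪ e , r ⟫ ≈ 0#
          r⟂e = scaled-⟂ e⟂z residual-⟂e
          r⟂w : ⟪ w , r ⟫ ≈ 0#
          r⟂w = scaled-⟂ w⟂z residual-⟂w
          r⟂z : ⟪ z , r ⟫ ≈ 0#
          r⟂z = projection-⟂ b‖z‖≈
          ‖r‖ : ‖ r ‖ ≈ n * n * ‖ residual ‖ - b * b * n
          ‖r‖ = trans (projection-‖‖ b‖z‖≈) (+-congʳ (‖•‖ n residual))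
          rearrange : ∀ E W n V X Y B →
            E * W * n * (n * n * (V - (X + W * Y)) - B * n) ≈ E * W * n * n * (n * V - (n * X + n * W * Y + B))
          rearrange = solve 7 (λ E W n V X Y B →
            E :* W :* n :* (n :* n :* (V :- (X :+ W :* Y)) :- B :* n)
              := E :* W :* n :* n :* (n :* V :- (n :* X :+ n :* W :* Y :+ B))) refl

    -- The argument of the theorem, in any ternary quadratic space: the
    -- arithmetic of O_K enters only through the hypotheses.
    module Obstruction
      {p} (Nonneg : Carrier → Set p) (Nonneg-resp : ∀ {a b} → a ≈ b → Nonneg a → Nonneg b)
      (norm-nonneg : ∀ v → Nonneg ‖ v ‖)
      (u s π τ : Carrier) (s*u≈1 : s * u ≈ 1#) (uππ-cancel : ∀ {r} → u * π * π * r ≈ 0# → r ≈ 0#)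
      (square-below-u : ∀ x → Nonneg (u - x * x) → x ≈ 0#)
      (squares-below-π : ∀ x y → Nonneg (π - (x * x + u * (y * y))) → x ≈ 0# × y ≈ 0#)
      (πτ-unrepresented : ∀ x y b → ¬ (π * τ ≈ π * (x * x) + π * u * (y * y) + b * b))
      (norm-1 : Σ (Vector Carrier) (λ v → ‖ v ‖ ≈ 1#)) (norm-u : Σ (Vector Carrier) (λ v → ‖ v ‖ ≈ u))
      (norm-π : Σ (Vector Carrier) (λ v → ‖ v ‖ ≈ π)) (norm-τ : Σ (Vector Carrier) (λ v → ‖ v ‖ ≈ τ)) where

      private
        e₁ w₀ z₀ v₀ : Vector Carrier
        e₁ = proj₁ norm-1
        w₀ = proj₁ norm-u
        z₀ = proj₁ norm-π
        v₀ = proj₁ norm-τ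

        ‖e₁‖≈1 : ‖ e₁ ‖ ≈ 1#
        ‖e₁‖≈1 = proj₂ norm-1
        ‖w₀‖≈u : ‖ w₀ ‖ ≈ u
        ‖w₀‖≈u = proj₂ norm-u
        ‖z₀‖≈π : ‖ z₀ ‖ ≈ π
        ‖z₀‖≈π = proj₂ norm-π
        ‖v₀‖≈τ : ‖ v₀ ‖ ≈ τ
        ‖v₀‖≈τ = proj₂ norm-τ

        module W = UnitCoordinate e₁ ‖e₁‖≈1 w₀

        e₂ : Vector Carrier
        e₂ = W.residual

        ‖e₂‖≈u-x² : ‖ e₂ ‖ ≈ u - W.x * W.x
        ‖e₂‖≈u-x² = trans W.residual-norm (+-congʳ ‖w₀‖≈u)

        ‖e₂‖≈u : ‖ e₂ ‖ ≈ u
        ‖e₂‖≈u = trans ‖e₂‖≈u-x² (x-y*0≈x u W.x (square-below-u W.x (Nonneg-resp ‖e₂‖≈u-x² (norm-nonneg e₂))))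

        s‖e₂‖≈1 : s * ‖ e₂ ‖ ≈ 1#
        s‖e₂‖≈1 = trans (*-congˡ ‖e₂‖≈u) s*u≈1

        module Z = Coordinates e₁ e₂ s ‖e₁‖≈1 s‖e₂‖≈1 W.residual-⟂ z₀

        e₃ : Vector Carrier
        e₃ = Z.residual

        ‖e₃‖≈π-x²-uy² : ‖ e₃ ‖ ≈ π - (Z.x * Z.x + u * (Z.y * Z.y))
        ‖e₃‖≈π-x²-uy² = trans Z.residual-norm (+-cong ‖z₀‖≈π (-‿cong (+-congˡ (*-congʳ ‖e₂‖≈u))))

        ‖e₃‖≈π : ‖ e₃ ‖ ≈ π
        ‖e₃‖≈π = trans ‖e₃‖≈π-x²-uy² (begin
          π - (Z.x * Z.x + u * (Z.y * Z.y))  ≈⟨ +-congˡ (-‿cong (+-cong (square≈0 x≈0) (*-congˡ (square≈0 y≈0)))) ⟩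
          π - (0# + u * 0#)                  ≈⟨ +-congˡ (-‿cong (+-identityˡ (u * 0#))) ⟩
          π - u * 0#                         ≈⟨ x-y*0≈x π u refl ⟩
          π                                  ∎)
          where
          x,y≈0 : Z.x ≈ 0# × Z.y ≈ 0#
          x,y≈0 = squares-below-π Z.x Z.y (Nonneg-resp ‖e₃‖≈π-x²-uy² (norm-nonneg e₃))
          x≈0 : Z.x ≈ 0#
          x≈0 = proj₁ x,y≈0
          y≈0 : Z.y ≈ 0#
          y≈0 = proj₂ x,y≈0
          square≈0 : ∀ {t} → t ≈ 0# → t * t ≈ 0#
          square≈0 {t} t≈0 = trans (*-congʳ t≈0) (zeroˡ t)

        module V = Coordinates e₁ e₂ s ‖e₁‖≈1 s‖e₂‖≈1 W.residual-⟂ v₀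

        cancel : ∀ {r} → ‖ e₁ ‖ * ‖ e₂ ‖ * ‖ e₃ ‖ * ‖ e₃ ‖ * r ≈ 0# → r ≈ 0#
        cancel {r} h = uππ-cancel (trans (*-congʳ (sym norms≈)) h)
          where
          norms≈ : ‖ e₁ ‖ * ‖ e₂ ‖ * ‖ e₃ ‖ * ‖ e₃ ‖ ≈ u * π * π
          norms≈ = trans (*-cong (*-cong (*-cong ‖e₁‖≈1 ‖e₂‖≈u) ‖e₃‖≈π) ‖e₃‖≈π)
            (*-congʳ (*-congʳ (*-identityˡ u)))

        b : Carrier
        b = V.b e₃ Z.residual-⟂e Z.residual-⟂w

      absurd : ⊥
      absurd = πτ-unrepresented V.x V.y b (begin
        π * τ                                                  ≈⟨ *-cong ‖e₃‖≈π ‖v₀‖≈τ ⟨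
        ‖ e₃ ‖ * ‖ v₀ ‖                                         ≈⟨ V.norm-in-coordinates e₃ Z.residual-⟂e Z.residual-⟂w cancel ⟩
        ‖ e₃ ‖ * (V.x * V.x) + ‖ e₃ ‖ * ‖ e₂ ‖ * (V.y * V.y) + b * b
          ≈⟨ +-congʳ (+-cong (*-congʳ ‖e₃‖≈π) (*-congʳ (*-cong ‖e₃‖≈π ‖e₂‖≈u))) ⟩
        π * (V.x * V.x) + π * u * (V.y * V.y) + b * b          ∎)

-- The ring of integers O_K = ℤ[α]

open import Defs
open import Algebra.Consequences.Propositional using (comm∧idˡ⇒idʳ; comm∧invˡ⇒invʳ; comm∧distrˡ⇒distrʳ)
open import Data.Bool using (true; false; T)
open import Data.Fin using (Fin)
open import Data.Fin.Patterns using (0F; 1F; 2F; 3F)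
open import Data.Integer using (+_; -[1+_]; -_; _+_; _*_; _<_; _≤_; +≤+; ∣_∣)
open import Data.Integer.Properties using (_≤?_; _<?_; _≟_)
open import Data.Integer.Solver using (module +-*-Solver)
open import Data.List using (List; []; _∷_; filter; cartesianProductWith)
open import Data.List.Membership.Propositional using (_∈_)
open import Data.List.Membership.Propositional.Properties using (∈-cartesianProductWith⁺; ∈-filter⁺)
open import Data.List.Relation.Unary.All using (All; all?; lookup)
open import Data.List.Relation.Unary.Any using (here; there)
open import Data.Nat using (ℕ; zero; suc; z≤n; _<ᵇ_)
import Data.Nat as ℕ
import Data.Nat.Properties as ℕ
open import Data.Sum using (inj₁; inj₂)
open import Function using (_$_)
open import Relation.Nullary.Decidable using (_×-dec_; _⊎-dec_; _→-dec_; ¬?; map′; from-yes)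
open import Relation.Binary.PropositionalEquality
open import Algebra.Structures {A = OK} _≡_ using (IsCommutativeRing)

open +-*-Solver using (Polynomial; con; var; _:+_; _:-_; _:*_; :-_; ⟦_⟧; ⟦_⟧↓; prove; solve; _:=_)

𝟙 : OK
𝟙 = ok (+ 1) 0ℤ 0ℤ 0ℤ

neg : OK → OK
neg (ok a₀ a₁ a₂ a₃) = ok (- a₀) (- a₁) (- a₂) (- a₃)

ι : ℤ → OK
ι m = ok m 0ℤ 0ℤ 0ℤ

ok-cong : ∀ {a₀ a₁ a₂ a₃ b₀ b₁ b₂ b₃} → a₀ ≡ b₀ → a₁ ≡ b₁ → a₂ ≡ b₂ → a₃ ≡ b₃ → ok a₀ a₁ a₂ a₃ ≡ ok b₀ b₁ b₂ b₃
ok-cong refl refl refl refl = refl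

-- Evaluating
-- p ⊗ᴾ q reproduces the formulas of _⊗_ literally, so identities between
-- coordinates of products can be left to the ring solver.
record OKᴾ (n : ℕ) : Set where
  constructor okᴾ
  field
    p0 p1 p2 p3 : Polynomial n

open OKᴾ

infixl 6 _⊕ᴾ_
infixl 7 _⊗ᴾ_

_⊕ᴾ_ : ∀ {n} → OKᴾ n → OKᴾ n → OKᴾ n
okᴾ x0 x1 x2 x3 ⊕ᴾ okᴾ y0 y1 y2 y3 = okᴾ (x0 :+ y0) (x1 :+ y1) (x2 :+ y2) (x3 :+ y3)

_⊗ᴾ_ : ∀ {n} → OKᴾ n → OKᴾ n → OKᴾ n
_⊗ᴾ_ {n} (okᴾ x0 x1 x2 x3) (okᴾ y0 y1 y2 y3) =
  okᴾ (c0 :- con (+ 5) :* c4 :- con (+ 25) :* c6)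
      (c1 :- con (+ 5) :* c5)
      (c2 :+ con (+ 5) :* c4 :+ con (+ 20) :* c6)
      (c3 :+ con (+ 5) :* c5)
  where
  c0 c1 c2 c3 c4 c5 c6 : Polynomial n
  c0 = x0 :* y0
  c1 = x0 :* y1 :+ x1 :* y0
  c2 = x0 :* y2 :+ x1 :* y1 :+ x2 :* y0
  c3 = x0 :* y3 :+ x1 :* y2 :+ x2 :* y1 :+ x3 :* y0
  c4 = x1 :* y3 :+ x2 :* y2 :+ x3 :* y1
  c5 = x2 :* y3 :+ x3 :* y2
  c6 = x3 :* y3

negᴾ : ∀ {n} → OKᴾ n → OKᴾ n
negᴾ (okᴾ x0 x1 x2 x3) = okᴾ (:- x0) (:- x1) (:- x2) (:- x3)

constᴾ : ∀ {n} → OK → OKᴾ n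
constᴾ (ok a₀ a₁ a₂ a₃) = okᴾ (con a₀) (con a₁) (con a₂) (con a₃)

ιᴾ : ∀ {n} → Polynomial n → OKᴾ n
ιᴾ p = okᴾ p (con 0ℤ) (con 0ℤ) (con 0ℤ)

⟦_⟧ᴾ : ∀ {n} → OKᴾ n → Vec ℤ n → OK
⟦ okᴾ x0 x1 x2 x3 ⟧ᴾ ρ = ok (⟦ x0 ⟧ ρ) (⟦ x1 ⟧ ρ) (⟦ x2 ⟧ ρ) (⟦ x3 ⟧ ρ)

by-normalisation : ∀ {n} ρ (p q : Polynomial n) → ⟦ p ⟧↓ ρ ≡ ⟦ q ⟧↓ ρ → ⟦ p ⟧ ρ ≡ ⟦ q ⟧ ρ
by-normalisation = prove

by-coordinates : ∀ {n} ρ (X Y : OKᴾ n) →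
  ⟦ p0 X ⟧↓ ρ ≡ ⟦ p0 Y ⟧↓ ρ → ⟦ p1 X ⟧↓ ρ ≡ ⟦ p1 Y ⟧↓ ρ →
  ⟦ p2 X ⟧↓ ρ ≡ ⟦ p2 Y ⟧↓ ρ → ⟦ p3 X ⟧↓ ρ ≡ ⟦ p3 Y ⟧↓ ρ →
  ⟦ X ⟧ᴾ ρ ≡ ⟦ Y ⟧ᴾ ρ
by-coordinates ρ X Y e0 e1 e2 e3 = ok-cong
  (by-normalisation ρ (p0 X) (p0 Y) e0) (by-normalisation ρ (p1 X) (p1 Y) e1)
  (by-normalisation ρ (p2 X) (p2 Y) e2) (by-normalisation ρ (p3 X) (p3 Y) e3)

coordinates : OK → Vec ℤ 4
coordinates (ok a₀ a₁ a₂ a₃) = a₀ ∷ a₁ ∷ a₂ ∷ a₃ ∷ []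

environment : OK → OK → OK → Vec ℤ 12
environment x y z = coordinates x ++ coordinates y ++ coordinates z

X Y Z : OKᴾ 12
X = okᴾ (var (# 0)) (var (# 1)) (var (# 2)) (var (# 3))
Y = okᴾ (var (# 4)) (var (# 5)) (var (# 6)) (var (# 7))
Z = okᴾ (var (# 8)) (var (# 9)) (var (# 10)) (var (# 11))

⊕-assoc : ∀ x y z → (x ⊕ y) ⊕ z ≡ x ⊕ (y ⊕ z)
⊕-assoc (ok x0 x1 x2 x3) (ok y0 y1 y2 y3) (ok z0 z1 z2 z3) =
  ok-cong (ℤ.+-assoc x0 y0 z0) (ℤ.+-assoc x1 y1 z1) (ℤ.+-assoc x2 y2 z2) (ℤ.+-assoc x3 y3 z3)

⊕-comm : ∀ x y → x ⊕ y ≡ y ⊕ x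
⊕-comm (ok x0 x1 x2 x3) (ok y0 y1 y2 y3) =
  ok-cong (ℤ.+-comm x0 y0) (ℤ.+-comm x1 y1) (ℤ.+-comm x2 y2) (ℤ.+-comm x3 y3)

⊕-identityˡ : ∀ x → 𝟘 ⊕ x ≡ x
⊕-identityˡ (ok x0 x1 x2 x3) =
  ok-cong (ℤ.+-identityˡ x0) (ℤ.+-identityˡ x1) (ℤ.+-identityˡ x2) (ℤ.+-identityˡ x3)

neg-inverseˡ : ∀ x → neg x ⊕ x ≡ 𝟘
neg-inverseˡ (ok x0 x1 x2 x3) =
  ok-cong (ℤ.+-inverseˡ x0) (ℤ.+-inverseˡ x1) (ℤ.+-inverseˡ x2) (ℤ.+-inverseˡ x3)

⊗-assoc : ∀ x y z → (x ⊗ y) ⊗ z ≡ x ⊗ (y ⊗ z)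
⊗-assoc x y z = by-coordinates (environment x y z) ((X ⊗ᴾ Y) ⊗ᴾ Z) (X ⊗ᴾ (Y ⊗ᴾ Z)) refl refl refl refl

⊗-comm : ∀ x y → x ⊗ y ≡ y ⊗ x
⊗-comm x y = by-coordinates (environment x y 𝟘) (X ⊗ᴾ Y) (Y ⊗ᴾ X) refl refl refl refl

⊗-identityˡ : ∀ x → 𝟙 ⊗ x ≡ x
⊗-identityˡ x = by-coordinates (environment x 𝟘 𝟘) (constᴾ 𝟙 ⊗ᴾ X) X refl refl refl refl

⊗-distribˡ : ∀ x y z → x ⊗ (y ⊕ z) ≡ x ⊗ y ⊕ x ⊗ z
⊗-distribˡ x y z = by-coordinates (environment x y z) (X ⊗ᴾ (Y ⊕ᴾ Z)) (X ⊗ᴾ Y ⊕ᴾ X ⊗ᴾ Z) refl refl refl refl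

isCommutativeRing : IsCommutativeRing _⊕_ _⊗_ neg 𝟘 𝟙
isCommutativeRing = record
  { isRing = record
    { +-isAbelianGroup = record
      { isGroup = record
        { isMonoid = record
          { isSemigroup = record
            { isMagma = record { isEquivalence = isEquivalence ; ∙-cong = cong₂ _⊕_ }
            ; assoc = ⊕-assoc }
          ; identity = ⊕-identityˡ , comm∧idˡ⇒idʳ ⊕-comm ⊕-identityˡ }
        ; inverse = neg-inverseˡ , comm∧invˡ⇒invʳ ⊕-comm neg-inverseˡ
        ; ⁻¹-cong = cong neg }
      ; comm = ⊕-comm }
    ; *-cong = cong₂ _⊗_
    ; *-assoc = ⊗-assoc
    ; *-identity = ⊗-identityˡ , comm∧idˡ⇒idʳ ⊗-comm ⊗-identityˡ
    ; distrib = ⊗-distribˡ , comm∧distrˡ⇒distrʳ ⊗-comm ⊗-distribˡ }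
  ; *-comm = ⊗-comm }

ring : CommutativeRing _ _
ring = record { isCommutativeRing = isCommutativeRing }

ι-morphism : +-*-rawRing -Raw-AlmostCommutative⟶ fromCommutativeRing ring
ι-morphism = record
  { ⟦_⟧ = ι
  ; +-homo = λ _ _ → refl
  ; *-homo = λ m n → by-coordinates (m ∷ n ∷ [])
      (ιᴾ (var (# 0) :* var (# 1))) (ιᴾ (var (# 0)) ⊗ᴾ ιᴾ (var (# 1))) refl refl refl refl
  ; -‿homo = λ _ → refl
  ; 0-homo = refl
  ; 1-homo = refl }

ι-⊗ : ∀ i r → ι i ⊗ r ≡ ok (i * a0 r) (i * a1 r) (i * a2 r) (i * a3 r)
ι-⊗ i r = by-coordinates (environment (ι i) r 𝟘) (ιᴾ (p0 X) ⊗ᴾ Y)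
  (okᴾ (p0 X :* p0 Y) (p0 X :* p1 Y) (p0 X :* p2 Y) (p0 X :* p3 Y)) refl refl refl refl

non-zero-divisor : ∀ {k} m n → m ⊗ k ≡ ι (+ suc n) → ∀ {r} → k ⊗ r ≡ 𝟘 → r ≡ 𝟘
non-zero-divisor {k} m n mk≡n+1 {r} kr≡0 =
  ok-cong (cancel (cong a0 [n+1]r≡0)) (cancel (cong a1 [n+1]r≡0)) (cancel (cong a2 [n+1]r≡0)) (cancel (cong a3 [n+1]r≡0))
  where
  [n+1]r≡0 : ok (+ suc n * a0 r) (+ suc n * a1 r) (+ suc n * a2 r) (+ suc n * a3 r) ≡ 𝟘
  [n+1]r≡0 = begin
    ok (+ suc n * a0 r) (+ suc n * a1 r) (+ suc n * a2 r) (+ suc n * a3 r) ≡⟨ ι-⊗ (+ suc n) r ⟨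
    ι (+ suc n) ⊗ r  ≡⟨ cong (_⊗ r) mk≡n+1 ⟨
    m ⊗ k ⊗ r        ≡⟨ ⊗-assoc m k r ⟩
    m ⊗ (k ⊗ r)      ≡⟨ cong (m ⊗_) kr≡0 ⟩
    m ⊗ 𝟘            ≡⟨ ⊗-comm m 𝟘 ⟩
    𝟘                ∎
    where open ≡-Reasoning
  cancel : ∀ {j} → + suc n * j ≡ 0ℤ → j ≡ 0ℤ
  cancel {j} h = ℤ.*-cancelˡ-≡ (+ suc n) j 0ℤ (trans h (sym (ℤ.*-zeroʳ (+ suc n))))

module 𝒪 = QuadraticSpace ring ι-morphism

-- The half-trace and total positivity

halfTrace : OK → ℤ
halfTrace (ok a₀ a₁ a₂ a₃) = + 2 * a₀ + + 5 * a₂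

halfTraceᴾ : ∀ {n} → OKᴾ n → Polynomial n
halfTraceᴾ X = con (+ 2) :* p0 X :+ con (+ 5) :* p2 X

halfTrace-⊕ : ∀ a b → halfTrace (a ⊕ b) ≡ halfTrace a + halfTrace b
halfTrace-⊕ a b = by-normalisation (environment a b 𝟘) (halfTraceᴾ (X ⊕ᴾ Y)) (halfTraceᴾ X :+ halfTraceᴾ Y) refl

halfTrace-neg : ∀ a → halfTrace (neg a) ≡ - halfTrace a
halfTrace-neg a = by-normalisation (environment a 𝟘 𝟘) (halfTraceᴾ (negᴾ X)) (:- halfTraceᴾ X) refl

neg-square : ∀ x → - x * - x ≡ x * x
neg-square = solve 1 (λ x → :- x :* :- x := x :* x) refl

Pos₅-asym : ∀ {p q} → Pos₅ ⟨ p , q ⟩√5 → ¬ Pos₅ ⟨ - p , - q ⟩√5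
Pos₅-asym (inj₁ (0≤p , 0≤q , p,q≢0)) (inj₁ (0≤-p , 0≤-q , _)) =
  p,q≢0 (ℤ.≤-antisym (ℤ.neg-cancel-≤ 0≤-p) 0≤p , ℤ.≤-antisym (ℤ.neg-cancel-≤ 0≤-q) 0≤q)
Pos₅-asym (inj₁ (0≤p , _)) (inj₂ (inj₁ (0<-p , _))) = ℤ.<-irrefl refl (ℤ.≤-<-trans 0≤p (ℤ.neg-cancel-< 0<-p))
Pos₅-asym (inj₁ (_ , 0≤q , _)) (inj₂ (inj₂ (_ , 0<-q , _))) = ℤ.<-irrefl refl (ℤ.≤-<-trans 0≤q (ℤ.neg-cancel-< 0<-q))
Pos₅-asym (inj₂ (inj₁ (0<p , _))) (inj₁ (0≤-p , _)) = ℤ.<-irrefl refl (ℤ.<-≤-trans 0<p (ℤ.neg-cancel-≤ 0≤-p))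
Pos₅-asym (inj₂ (inj₁ (0<p , _))) (inj₂ (inj₁ (0<-p , _))) = ℤ.<-asym 0<p (ℤ.neg-cancel-< 0<-p)
Pos₅-asym {p} {q} (inj₂ (inj₁ (_ , _ , 5q²<p²))) (inj₂ (inj₂ (_ , _ , p²<5q²))) =
  ℤ.<-asym 5q²<p² (subst₂ _<_ (neg-square p) (cong (+ 5 *_) (neg-square q)) p²<5q²)
Pos₅-asym (inj₂ (inj₂ (_ , 0<q , _))) (inj₁ (_ , 0≤-q , _)) = ℤ.<-irrefl refl (ℤ.<-≤-trans 0<q (ℤ.neg-cancel-≤ 0≤-q))
Pos₅-asym {p} {q} (inj₂ (inj₂ (_ , _ , p²<5q²))) (inj₂ (inj₁ (_ , _ , 5q²<p²))) =
  ℤ.<-asym p²<5q² (subst₂ _<_ (cong (+ 5 *_) (neg-square q)) (neg-square p) 5q²<p²)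
Pos₅-asym (inj₂ (inj₂ (p<0 , _))) (inj₂ (inj₂ (-p<0 , _))) = ℤ.<-asym p<0 (ℤ.neg-cancel-< -p<0)

Pos₅-conjugates : ∀ {p q} → Pos₅ ⟨ p , q ⟩√5 → Pos₅ ⟨ p , - q ⟩√5 → 0ℤ < p
Pos₅-conjugates (inj₂ (inj₁ (0<p , _))) _ = 0<p
Pos₅-conjugates _ (inj₂ (inj₁ (0<p , _))) = 0<p
Pos₅-conjugates (inj₁ (0≤p , 0≤q , p,q≢0)) (inj₁ (_ , 0≤-q , _)) =
  ℤ.≤∧≢⇒< 0≤p (λ 0≡p → p,q≢0 (sym 0≡p , ℤ.≤-antisym (ℤ.neg-cancel-≤ 0≤-q) 0≤q))
Pos₅-conjugates (inj₁ (0≤p , _)) (inj₂ (inj₂ (p<0 , _))) = ⊥-elim (ℤ.<-irrefl refl (ℤ.≤-<-trans 0≤p p<0))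
Pos₅-conjugates (inj₂ (inj₂ (p<0 , _))) (inj₁ (0≤p , _)) = ⊥-elim (ℤ.<-irrefl refl (ℤ.≤-<-trans 0≤p p<0))
Pos₅-conjugates (inj₂ (inj₂ (_ , 0<q , _))) (inj₂ (inj₂ (_ , 0<-q , _))) = ⊥-elim (ℤ.<-asym 0<q (ℤ.neg-cancel-< 0<-q))

-- The embeddings with δ = ±1 differ only in the sign of the √s-part, so they
-- cannot both be positive unless C (twice their sum) is.
EmbPos-sum : ∀ ε a → EmbPos ε true a → EmbPos ε false a → Pos₅ ⟨ halfTrace a , sg ε (a2 a) ⟩√5
EmbPos-sum ε a (inj₁ (C>0 , _)) _ = C>0
EmbPos-sum ε a (inj₂ _) (inj₁ (C>0 , _)) = C>0
EmbPos-sum ε a (inj₂ (_ , D>0 , _)) (inj₂ (_ , -D>0 , _)) = ⊥-elim (Pos₅-asym D>0 -D>0)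

totallyPositive⇒halfTrace>0 : ∀ {a} → TotPos a → 0ℤ < halfTrace a
totallyPositive⇒halfTrace>0 {a} a≫0 =
  Pos₅-conjugates (EmbPos-sum true a (a≫0 true true) (a≫0 true false))
                  (EmbPos-sum false a (a≫0 false true) (a≫0 false false))

Pos₅? : ∀ x → Dec (Pos₅ x)
Pos₅? ⟨ p , q ⟩√5 =
        (0ℤ ≤? p ×-dec 0ℤ ≤? q ×-dec ¬? (p ≟ 0ℤ ×-dec q ≟ 0ℤ))
  ⊎-dec (0ℤ <? p ×-dec q <? 0ℤ ×-dec + 5 * (q * q) <? p * p)
  ⊎-dec (p <? 0ℤ ×-dec 0ℤ <? q ×-dec p * p <? + 5 * (q * q))

NonNeg₅? : ∀ x → Dec (NonNeg₅ x)
NonNeg₅? x = Pos₅? x ⊎-dec (re x ≟ 0ℤ ×-dec ir x ≟ 0ℤ)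

EmbPos? : ∀ ε δ a → Dec (EmbPos ε δ a)
EmbPos? ε δ (ok _ _ _ _) =
  (Pos₅? _ ×-dec (NonNeg₅? _ ⊎-dec Pos₅? _)) ⊎-dec (¬? (Pos₅? _) ×-dec Pos₅? _ ×-dec Pos₅? _)

TotPos? : ∀ a → Dec (TotPos a)
TotPos? a = map′ all-embeddings (λ a≫0 → a≫0 true true , a≫0 true false , a≫0 false true , a≫0 false false)
  (EmbPos? true true a ×-dec EmbPos? true false a ×-dec EmbPos? false true a ×-dec EmbPos? false false a)
  where
  all-embeddings : EmbPos true true a × EmbPos true false a × EmbPos false true a × EmbPos false false a → TotPos a
  all-embeddings (p , _ , _ , _) true true = p
  all-embeddings (_ , p , _ , _) true false = p
  all-embeddings (_ , _ , p , _) false true = p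
  all-embeddings (_ , _ , _ , p) false false = p

infix 4 _≟ᴼ_
_≟ᴼ_ : (a b : OK) → Dec (a ≡ b)
ok a₀ a₁ a₂ a₃ ≟ᴼ ok b₀ b₁ b₂ b₃ =
  map′ (λ { (refl , refl , refl , refl) → refl }) (λ { refl → refl , refl , refl , refl })
    (a₀ ≟ b₀ ×-dec a₁ ≟ b₁ ×-dec a₂ ≟ b₂ ×-dec a₃ ≟ b₃)

data ZeroOrTotPos (a : OK) : Set where
  is-zero : a ≡ 𝟘 → ZeroOrTotPos a
  is-totPos : TotPos a → ZeroOrTotPos a

ZeroOrTotPos? : ∀ a → Dec (ZeroOrTotPos a)
ZeroOrTotPos? a = map′ (λ { (inj₁ p) → is-zero p ; (inj₂ p) → is-totPos p }) (λ { (is-zero p) → inj₁ p ; (is-totPos p) → inj₂ p })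
  (a ≟ᴼ 𝟘 ⊎-dec TotPos? a)

ZeroOrTotPos-resp : ∀ {a b} → a ≡ b → ZeroOrTotPos a → ZeroOrTotPos b
ZeroOrTotPos-resp refl a⪰0 = a⪰0

0≤halfTrace : ∀ a → ZeroOrTotPos a → 0ℤ ≤ halfTrace a
0≤halfTrace a (is-zero refl) = ℤ.≤-refl
0≤halfTrace a (is-totPos a≫0) = ℤ.<⇒≤ (totallyPositive⇒halfTrace>0 {a} a≫0)

halfTrace-mono : ∀ a b → ZeroOrTotPos (a ⊕ neg b) → halfTrace b ≤ halfTrace a
halfTrace-mono a b a-b⪰0 = ℤ.0≤i-j⇒j≤i
  (subst (0ℤ ≤_) (trans (halfTrace-⊕ a (neg b)) (cong (_+_ (halfTrace a)) (halfTrace-neg b))) (0≤halfTrace (a ⊕ neg b) a-b⪰0))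

-- Elements s with P(k s²) ≤ 10, by sums of squares and enumeration

coordinate : Fin 4 → OK → ℤ
coordinate 0F = a0
coordinate 1F = a1
coordinate 2F = a2
coordinate 3F = a3

coordinateᴾ : ∀ {n} → Fin 4 → OKᴾ n → Polynomial n
coordinateᴾ 0F = p0
coordinateᴾ 1F = p1
coordinateᴾ 2F = p2
coordinateᴾ 3F = p3

coordinate-correct : ∀ i s → ⟦ coordinateᴾ i X ⟧ (environment s 𝟘 𝟘) ≡ coordinate i s
coordinate-correct 0F s = refl
coordinate-correct 1F s = refl
coordinate-correct 2F s = refl
coordinate-correct 3F s = refl

infix 8 _⊙_
_⊙_ : OK → OK → ℤ
ok l₀ l₁ l₂ l₃ ⊙ ok s₀ s₁ s₂ s₃ = l₀ * s₀ + l₁ * s₁ + l₂ * s₂ + l₃ * s₃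

sumOfSquares : List (ℕ × OK) → OK → ℤ
sumOfSquares [] s = 0ℤ
sumOfSquares ((w , ℓ) ∷ ws) s = + w * ((ℓ ⊙ s) * (ℓ ⊙ s)) + sumOfSquares ws s

sumOfSquaresᴾ : ∀ {n} → List (ℕ × OK) → OKᴾ n → Polynomial n
sumOfSquaresᴾ [] S = con 0ℤ
sumOfSquaresᴾ {n} ((w , ok l₀ l₁ l₂ l₃) ∷ ws) S = con (+ w) :* (L :* L) :+ sumOfSquaresᴾ ws S
  where
  L : Polynomial n
  L = con l₀ :* p0 S :+ con l₁ :* p1 S :+ con l₂ :* p2 S :+ con l₃ :* p3 S

sumOfSquares-correct : ∀ ws s → ⟦ sumOfSquaresᴾ ws X ⟧ (environment s 𝟘 𝟘) ≡ sumOfSquares ws s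
sumOfSquares-correct [] s = refl
sumOfSquares-correct ((w , ℓ@(ok _ _ _ _)) ∷ ws) s = cong (_+_ (+ w * ((ℓ ⊙ s) * (ℓ ⊙ s)))) (sumOfSquares-correct ws s)

square≡∣∣² : ∀ s → s * s ≡ + (∣ s ∣ ℕ.* ∣ s ∣)
square≡∣∣² (+ n) = ℤ.+◃n≡+n (n ℕ.* n)
square≡∣∣² -[1+ n ] = refl

0≤weighted-square : ∀ w s → 0ℤ ≤ + w * (s * s)
0≤weighted-square w s rewrite square≡∣∣² s = subst (0ℤ ≤_) (ℤ.pos-* w _) (+≤+ z≤n)

0≤sumOfSquares : ∀ ws s → 0ℤ ≤ sumOfSquares ws s
0≤sumOfSquares [] s = ℤ.≤-refl
0≤sumOfSquares ((w , ℓ) ∷ ws) s = ℤ.+-mono-≤ (0≤weighted-square w (ℓ ⊙ s)) (0≤sumOfSquares ws s)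

0≤m*i⇒0≤i : ∀ {m i} → 0 ℕ.< m → 0ℤ ≤ + m * i → 0ℤ ≤ i
0≤m*i⇒0≤i {suc m} {i} _ 0≤mi =
  ℤ.*-cancelˡ-≤-pos 0ℤ i (+ suc m) (subst (_≤ + suc m * i) (sym (ℤ.*-zeroʳ (+ suc m))) 0≤mi)

square-bound : ∀ {K N : ℕ} {T R : ℤ} M d s → + M * T ≡ + d * (s * s) + R → 0ℤ ≤ R → T ≤ + K →
  M ℕ.* K ℕ.< d ℕ.* (suc N ℕ.* suc N) → ∣ s ∣ ℕ.≤ N
square-bound {K} {N} {T} {R} M d s eq 0≤R T≤K sharp with ∣ s ∣ ℕ.≤? N
... | yes ∣s∣≤N = ∣s∣≤N
... | no ∣s∣≰N = ⊥-elim (ℕ.<-irrefl refl (ℕ.<-≤-trans sharp (ℕ.≤-trans d[N+1]²≤ds² ds²≤MK)))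
  where
  open ℤ.≤-Reasoning
  ds²≤MK : d ℕ.* (∣ s ∣ ℕ.* ∣ s ∣) ℕ.≤ M ℕ.* K
  ds²≤MK = ℤ.drop‿+≤+ (begin
    + (d ℕ.* (∣ s ∣ ℕ.* ∣ s ∣))  ≡⟨ ℤ.pos-* d _ ⟩
    + d * + (∣ s ∣ ℕ.* ∣ s ∣)    ≡⟨ cong (+ d *_) (square≡∣∣² s) ⟨
    + d * (s * s)               ≡⟨ ℤ.+-identityʳ _ ⟨
    + d * (s * s) + 0ℤ          ≤⟨ ℤ.+-monoʳ-≤ (+ d * (s * s)) 0≤R ⟩
    + d * (s * s) + R           ≡⟨ eq ⟨
    + M * T                     ≤⟨ ℤ.*-monoˡ-≤-nonNeg (+ M) T≤K ⟩
    + M * + K                   ≡⟨ ℤ.pos-* M K ⟨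
    + (M ℕ.* K)                 ∎)
  d[N+1]²≤ds² : d ℕ.* (suc N ℕ.* suc N) ℕ.≤ d ℕ.* (∣ s ∣ ℕ.* ∣ s ∣)
  d[N+1]²≤ds² = ℕ.*-monoʳ-≤ d (ℕ.*-mono-≤ (ℕ.≰⇒> ∣s∣≰N) (ℕ.≰⇒> ∣s∣≰N))

record Certificate (k : OK) (i : Fin 4) (N : ℕ) : Set where
  field
    scale weight : ℕ
    squares : List (ℕ × OK)
    identity : ∀ s → + scale * halfTrace (k ⊗ (s ⊗ s)) ≡ + weight * (coordinate i s * coordinate i s) + sumOfSquares squares s
    0<scale : 0 ℕ.< scale
    sharp : scale ℕ.* 10 ℕ.< weight ℕ.* (suc N ℕ.* suc N)

certify : ∀ {k i N} scale weight squares →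
  (∀ s → ⟦ con (+ scale) :* halfTraceᴾ (constᴾ k ⊗ᴾ (X ⊗ᴾ X)) ⟧↓ (environment s 𝟘 𝟘)
       ≡ ⟦ con (+ weight) :* (coordinateᴾ i X :* coordinateᴾ i X) :+ sumOfSquaresᴾ squares X ⟧↓ (environment s 𝟘 𝟘)) →
  T (0 <ᵇ scale) → T (scale ℕ.* 10 <ᵇ weight ℕ.* (suc N ℕ.* suc N)) → Certificate k i N
certify {k} {i} scale weight squares normal-forms 0<scale sharp = record
  { scale = scale ; weight = weight ; squares = squares
  ; identity = identity
  ; 0<scale = ℕ.<ᵇ⇒< 0 scale 0<scale
  ; sharp = ℕ.<ᵇ⇒< _ _ sharp }
  where
  identity : ∀ s → + scale * halfTrace (k ⊗ (s ⊗ s)) ≡ + weight * (coordinate i s * coordinate i s) + sumOfSquares squares s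
  identity s = trans
    (by-normalisation (environment s 𝟘 𝟘) (con (+ scale) :* halfTraceᴾ (constᴾ k ⊗ᴾ (X ⊗ᴾ X)))
      (con (+ weight) :* (coordinateᴾ i X :* coordinateᴾ i X) :+ sumOfSquaresᴾ squares X) (normal-forms s))
    (cong₂ (λ sᵢ r → + weight * (sᵢ * sᵢ) + r) (coordinate-correct i s) (sumOfSquares-correct squares s))

module _ {k i N} (C : Certificate k i N) where
  open Certificate C

  certified-bound : ∀ s → halfTrace (k ⊗ (s ⊗ s)) ≤ + 10 → ∣ coordinate i s ∣ ℕ.≤ N
  certified-bound s small = square-bound scale weight (coordinate i s) (identity s) (0≤sumOfSquares squares s) small sharp

  certified-nonneg : ∀ s → 0ℤ ≤ halfTrace (k ⊗ (s ⊗ s))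
  certified-nonneg s = 0≤m*i⇒0≤i 0<scale (subst (0ℤ ≤_) (sym (identity s))
    (ℤ.+-mono-≤ (0≤weighted-square weight (coordinate i s)) (0≤sumOfSquares squares s)))

symmetricRange : ℕ → List ℤ
symmetricRange zero = + 0 ∷ []
symmetricRange (suc N) = + suc N ∷ -[1+ N ] ∷ symmetricRange N

∈-symmetricRange : ∀ {N s} → ∣ s ∣ ℕ.≤ N → s ∈ symmetricRange N
∈-symmetricRange {zero} {+ zero} _ = here refl
∈-symmetricRange {suc N} {s} ∣s∣≤1+N with ℕ.m≤n⇒m<n∨m≡n ∣s∣≤1+N
... | inj₁ ∣s∣<1+N = there (there (∈-symmetricRange (ℕ.≤-pred ∣s∣<1+N)))
∈-symmetricRange {suc N} {+ .(suc N)} _ | inj₂ refl = here refl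
∈-symmetricRange {suc N} { -[1+ .N ]} _ | inj₂ refl = there (here refl)

box : ℕ → ℕ → ℕ → ℕ → List OK
box N₀ N₁ N₂ N₃ =
  cartesianProductWith _$_
    (cartesianProductWith _$_ (cartesianProductWith ok (symmetricRange N₀) (symmetricRange N₁)) (symmetricRange N₂))
    (symmetricRange N₃)

∈-box : ∀ {N₀ N₁ N₂ N₃ s} →
  ∣ a0 s ∣ ℕ.≤ N₀ → ∣ a1 s ∣ ℕ.≤ N₁ → ∣ a2 s ∣ ℕ.≤ N₂ → ∣ a3 s ∣ ℕ.≤ N₃ → s ∈ box N₀ N₁ N₂ N₃
∈-box b₀ b₁ b₂ b₃ =
  ∈-cartesianProductWith⁺ _$_
    (∈-cartesianProductWith⁺ _$_ (∈-cartesianProductWith⁺ ok (∈-symmetricRange b₀) (∈-symmetricRange b₁)) (∈-symmetricRange b₂))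
    (∈-symmetricRange b₃)

-- 10 = P(πτ) is the largest half-trace the argument needs to bound.
record SmallSquares (k : OK) : Set where
  field
    N₀ N₁ N₂ N₃ : ℕ
    bound₀ : Certificate k 0F N₀
    bound₁ : Certificate k 1F N₁
    bound₂ : Certificate k 2F N₂
    bound₃ : Certificate k 3F N₃

  candidates : List OK
  candidates = filter (λ s → halfTrace (k ⊗ (s ⊗ s)) ≤? + 10) (box N₀ N₁ N₂ N₃)

  ∈-candidates : ∀ s → halfTrace (k ⊗ (s ⊗ s)) ≤ + 10 → s ∈ candidates
  ∈-candidates s small = ∈-filter⁺ (λ s → halfTrace (k ⊗ (s ⊗ s)) ≤? + 10)
    (∈-box (certified-bound bound₀ s small) (certified-bound bound₁ s small)
           (certified-bound bound₂ s small) (certified-bound bound₃ s small))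
    small

  nonneg : ∀ s → 0ℤ ≤ halfTrace (k ⊗ (s ⊗ s))
  nonneg = certified-nonneg bound₀

open SmallSquares using (candidates; ∈-candidates; nonneg)

u u⁻¹ π τ : OK
u = ok (+ 2) (+ 1) 0ℤ 0ℤ
u⁻¹ = ok (- + 2) (+ 1) (+ 2) (- + 1)
π = ok 0ℤ (+ 1) (+ 1) 0ℤ
τ = ok 0ℤ (+ 2) (+ 1) (- + 1)

squares₁ : SmallSquares 𝟙
squares₁ = record
  { N₀ = 5 ; N₁ = 4 ; N₂ = 2 ; N₃ = 1
  ; bound₀ = certify 6 2 ((10 , ok (+ 1) 0ℤ (+ 3) 0ℤ) ∷ (3 , ok 0ℤ (+ 3) 0ℤ (+ 10)) ∷ (3 , ok 0ℤ (+ 1) 0ℤ 0ℤ) ∷ []) (λ _ → refl) _ _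
  ; bound₁ = certify 2 1 ((1 , ok (+ 2) 0ℤ (+ 5) 0ℤ) ∷ (5 , ok 0ℤ 0ℤ (+ 1) 0ℤ) ∷ (1 , ok 0ℤ (+ 3) 0ℤ (+ 10)) ∷ []) (λ _ → refl) _ _
  ; bound₂ = certify 2 5 ((1 , ok (+ 2) 0ℤ (+ 5) 0ℤ) ∷ (1 , ok 0ℤ (+ 3) 0ℤ (+ 10)) ∷ (1 , ok 0ℤ (+ 1) 0ℤ 0ℤ) ∷ []) (λ _ → refl) _ _
  ; bound₃ = certify 2 10 ((1 , ok (+ 2) 0ℤ (+ 5) 0ℤ) ∷ (10 , ok 0ℤ (+ 1) 0ℤ (+ 3)) ∷ (5 , ok 0ℤ 0ℤ (+ 1) 0ℤ) ∷ []) (λ _ → refl) _ _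
  }

squaresᵤ : SmallSquares u
squaresᵤ = record
  { N₀ = 6 ; N₁ = 4 ; N₂ = 3 ; N₃ = 2
  ; bound₀ = certify 4 1 ((1 , ok (+ 3) (+ 6) (+ 10) (+ 20)) ∷ (1 , ok (+ 1) (+ 2) 0ℤ 0ℤ) ∷ (5 , ok (+ 1) 0ℤ (+ 2) 0ℤ) ∷ []) (λ _ → refl) _ _
  ; bound₁ = certify 4 2 ((1 , ok (+ 3) (+ 6) (+ 10) (+ 20)) ∷ (5 , ok (+ 1) 0ℤ (+ 2) 0ℤ) ∷ (2 , ok (+ 1) (+ 1) 0ℤ 0ℤ) ∷ []) (λ _ → refl) _ _
  ; bound₂ = certify 12 10 ((3 , ok (+ 3) (+ 6) (+ 10) (+ 20)) ∷ (3 , ok (+ 1) (+ 2) 0ℤ 0ℤ) ∷ (2 , ok (+ 3) 0ℤ (+ 5) 0ℤ) ∷ []) (λ _ → refl) _ _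
  ; bound₃ = certify 4 10 ((1 , ok (+ 4) (+ 5) (+ 10) (+ 15)) ∷ (5 , ok 0ℤ (+ 1) (+ 2) (+ 5)) ∷ (10 , ok 0ℤ (+ 1) 0ℤ (+ 2)) ∷ []) (λ _ → refl) _ _
  }

squaresᵖ : SmallSquares π
squaresᵖ = record
  { N₀ = 8 ; N₁ = 7 ; N₂ = 2 ; N₃ = 2
  ; bound₀ = certify 7 1 ((1 , ok (+ 3) (+ 10) (+ 10) (+ 35)) ∷ (5 , ok (+ 1) (+ 1) (+ 1) 0ℤ) ∷ (5 , ok (+ 2) 0ℤ (+ 7) 0ℤ) ∷ []) (λ _ → refl) _ _
  ; bound₁ = certify 10 2 ((5 , ok (+ 3) (+ 3) (+ 10) (+ 10)) ∷ (5 , ok (+ 1) (+ 1) 0ℤ 0ℤ) ∷ (2 , ok 0ℤ (+ 7) 0ℤ (+ 25)) ∷ []) (λ _ → refl) _ _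
  ; bound₂ = certify 3 5 ((5 , ok (+ 1) (+ 3) (+ 3) (+ 10)) ∷ (1 , ok (- + 1) 0ℤ 0ℤ (+ 5)) ∷ (1 , ok (+ 3) 0ℤ (+ 10) 0ℤ) ∷ []) (λ _ → refl) _ _
  ; bound₃ = certify 2 5 ((1 , ok (+ 3) (+ 3) (+ 10) (+ 10)) ∷ (1 , ok (+ 1) (+ 1) 0ℤ 0ℤ) ∷ (5 , ok 0ℤ (+ 2) 0ℤ (+ 7)) ∷ []) (λ _ → refl) _ _
  }

squaresᵖᵘ : SmallSquares (π ⊗ u)
squaresᵖᵘ = record
  { N₀ = 9 ; N₁ = 7 ; N₂ = 3 ; N₃ = 2
  ; bound₀ = certify 9 1 ((5 , ok (+ 5) (+ 9) (+ 16) (+ 30)) ∷ (1 , ok (- + 2) 0ℤ (+ 5) (+ 15)) ∷ (5 , ok (+ 1) 0ℤ (+ 3) 0ℤ) ∷ []) (λ _ → refl) _ _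
  ; bound₁ = certify 6 1 ((1 , ok (+ 9) (+ 16) (+ 30) (+ 55)) ∷ (1 , ok (+ 3) (+ 2) 0ℤ (- + 5)) ∷ (1 , ok 0ℤ (+ 3) 0ℤ (+ 10)) ∷ []) (λ _ → refl) _ _
  ; bound₂ = certify 6 5 ((10 , ok (+ 3) (+ 5) (+ 9) (+ 16)) ∷ (5 , ok 0ℤ (+ 2) (+ 3) (+ 10)) ∷ (10 , ok 0ℤ 0ℤ (+ 2) (+ 3)) ∷ []) (λ _ → refl) _ _
  ; bound₃ = certify 6 10 ((1 , ok (+ 9) (+ 16) (+ 30) (+ 55)) ∷ (1 , ok (+ 3) (+ 2) 0ℤ (- + 5)) ∷ (10 , ok 0ℤ (+ 1) 0ℤ (+ 3)) ∷ []) (λ _ → refl) _ _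
  }

-- The three exhaustive searches

only-trivial-square-below-u : All (λ x → ZeroOrTotPos (u ⊕ neg (x ⊗ x)) → x ≡ 𝟘) (candidates squares₁)
only-trivial-square-below-u = from-yes (all? (λ x → ZeroOrTotPos? (u ⊕ neg (x ⊗ x)) →-dec x ≟ᴼ 𝟘) (candidates squares₁))

-- The candidate lists are arguments so that each is computed only once.
OnlyTrivialBelowπ : List OK → List OK → Set
OnlyTrivialBelowπ xs ys = All (λ x → All (λ y → ZeroOrTotPos (π ⊕ neg (x ⊗ x ⊕ u ⊗ (y ⊗ y))) → x ≡ 𝟘 × y ≡ 𝟘) ys) xs

onlyTrivialBelowπ? : ∀ xs ys → Dec (OnlyTrivialBelowπ xs ys)
onlyTrivialBelowπ? xs ys = all? (λ x → all? (λ y →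
  ZeroOrTotPos? (π ⊕ neg (x ⊗ x ⊕ u ⊗ (y ⊗ y))) →-dec (x ≟ᴼ 𝟘 ×-dec y ≟ᴼ 𝟘)) ys) xs

only-trivial-pairs-below-π : OnlyTrivialBelowπ (candidates squares₁) (candidates squaresᵤ)
only-trivial-pairs-below-π = from-yes (onlyTrivialBelowπ? (candidates squares₁) (candidates squaresᵤ))

NoSolution : List OK → List OK → List OK → Set
NoSolution xs ys bs = All (λ x → All (λ y → halfTrace (π ⊗ (x ⊗ x)) + halfTrace (π ⊗ u ⊗ (y ⊗ y)) ≤ + 10 →
  All (λ b → π ⊗ τ ≢ π ⊗ (x ⊗ x) ⊕ π ⊗ u ⊗ (y ⊗ y) ⊕ b ⊗ b) bs) ys) xs

noSolution? : ∀ xs ys bs → Dec (NoSolution xs ys bs)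
noSolution? xs ys bs = all? (λ x → all? (λ y → halfTrace (π ⊗ (x ⊗ x)) + halfTrace (π ⊗ u ⊗ (y ⊗ y)) ≤? + 10 →-dec
  all? (λ b → ¬? (π ⊗ τ ≟ᴼ π ⊗ (x ⊗ x) ⊕ π ⊗ u ⊗ (y ⊗ y) ⊕ b ⊗ b)) bs) ys) xs

no-solution : NoSolution (candidates squaresᵖ) (candidates squaresᵖᵘ) (candidates squares₁)
no-solution = from-yes (noSolution? (candidates squaresᵖ) (candidates squaresᵖᵘ) (candidates squares₁))

halfTrace-𝟙⊗ : ∀ a → halfTrace (𝟙 ⊗ a) ≡ halfTrace a
halfTrace-𝟙⊗ a = cong halfTrace (⊗-identityˡ a)

≤-split : ∀ {p q K} → 0ℤ ≤ p → 0ℤ ≤ q → p + q ≤ K → p ≤ K × q ≤ K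
≤-split {p} {q} 0≤p 0≤q p+q≤K =
  ℤ.≤-trans (subst (_≤ p + q) (ℤ.+-identityʳ p) (ℤ.+-monoʳ-≤ p 0≤q)) p+q≤K ,
  ℤ.≤-trans (subst (_≤ p + q) (ℤ.+-identityˡ q) (ℤ.+-monoˡ-≤ q 0≤p)) p+q≤K

square-below-u : ∀ x → ZeroOrTotPos (u ⊕ neg (x ⊗ x)) → x ≡ 𝟘
square-below-u x u-x²⪰0 = lookup only-trivial-square-below-u (∈-candidates squares₁ x x²≤10) u-x²⪰0
  where
  x²≤10 : halfTrace (𝟙 ⊗ (x ⊗ x)) ≤ + 10
  x²≤10 = subst (_≤ + 10) (sym (halfTrace-𝟙⊗ (x ⊗ x)))
    (ℤ.≤-trans (halfTrace-mono u (x ⊗ x) u-x²⪰0) (from-yes (halfTrace u ≤? + 10)))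

squares-below-π : ∀ x y → ZeroOrTotPos (π ⊕ neg (x ⊗ x ⊕ u ⊗ (y ⊗ y))) → x ≡ 𝟘 × y ≡ 𝟘
squares-below-π x y π-x²-uy²⪰0 =
  lookup (lookup only-trivial-pairs-below-π (∈-candidates squares₁ x x²≤10)) (∈-candidates squaresᵤ y uy²≤10) π-x²-uy²⪰0
  where
  x²+uy²≤5 : halfTrace (x ⊗ x) + halfTrace (u ⊗ (y ⊗ y)) ≤ + 5
  x²+uy²≤5 = subst (_≤ + 5) (halfTrace-⊕ (x ⊗ x) (u ⊗ (y ⊗ y))) (halfTrace-mono π (x ⊗ x ⊕ u ⊗ (y ⊗ y)) π-x²-uy²⪰0)
  split : halfTrace (x ⊗ x) ≤ + 5 × halfTrace (u ⊗ (y ⊗ y)) ≤ + 5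
  split = ≤-split (subst (0ℤ ≤_) (halfTrace-𝟙⊗ (x ⊗ x)) (nonneg squares₁ x)) (nonneg squaresᵤ y) x²+uy²≤5
  5≤10 : + 5 ≤ + 10
  5≤10 = from-yes (+ 5 ≤? + 10)
  x²≤10 : halfTrace (𝟙 ⊗ (x ⊗ x)) ≤ + 10
  x²≤10 = subst (_≤ + 10) (sym (halfTrace-𝟙⊗ (x ⊗ x))) (ℤ.≤-trans (proj₁ split) 5≤10)
  uy²≤10 : halfTrace (u ⊗ (y ⊗ y)) ≤ + 10
  uy²≤10 = ℤ.≤-trans (proj₂ split) 5≤10

πτ-unrepresented : ∀ x y b → π ⊗ τ ≢ π ⊗ (x ⊗ x) ⊕ π ⊗ u ⊗ (y ⊗ y) ⊕ b ⊗ b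
πτ-unrepresented x y b eq =
  lookup (lookup (lookup no-solution (∈-candidates squaresᵖ x (proj₁ first-two))) (∈-candidates squaresᵖᵘ y (proj₂ first-two))
    (proj₁ all-three)) (∈-candidates squares₁ b b²≤10) eq
  where
  sum≡10 : halfTrace (π ⊗ (x ⊗ x)) + halfTrace (π ⊗ u ⊗ (y ⊗ y)) + halfTrace (b ⊗ b) ≡ + 10
  sum≡10 = begin
    halfTrace (π ⊗ (x ⊗ x)) + halfTrace (π ⊗ u ⊗ (y ⊗ y)) + halfTrace (b ⊗ b)
      ≡⟨ cong (_+ halfTrace (b ⊗ b)) (halfTrace-⊕ (π ⊗ (x ⊗ x)) (π ⊗ u ⊗ (y ⊗ y))) ⟨
    halfTrace (π ⊗ (x ⊗ x) ⊕ π ⊗ u ⊗ (y ⊗ y)) + halfTrace (b ⊗ b)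
      ≡⟨ halfTrace-⊕ (π ⊗ (x ⊗ x) ⊕ π ⊗ u ⊗ (y ⊗ y)) (b ⊗ b) ⟨
    halfTrace (π ⊗ (x ⊗ x) ⊕ π ⊗ u ⊗ (y ⊗ y) ⊕ b ⊗ b)
      ≡⟨ cong halfTrace eq ⟨
    halfTrace (π ⊗ τ)
      ≡⟨⟩
    + 10 ∎
    where open ≡-Reasoning
  πx²≥0 : 0ℤ ≤ halfTrace (π ⊗ (x ⊗ x))
  πx²≥0 = nonneg squaresᵖ x
  πuy²≥0 : 0ℤ ≤ halfTrace (π ⊗ u ⊗ (y ⊗ y))
  πuy²≥0 = nonneg squaresᵖᵘ y
  b²≥0 : 0ℤ ≤ halfTrace (b ⊗ b)
  b²≥0 = subst (0ℤ ≤_) (halfTrace-𝟙⊗ (b ⊗ b)) (nonneg squares₁ b)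
  all-three : halfTrace (π ⊗ (x ⊗ x)) + halfTrace (π ⊗ u ⊗ (y ⊗ y)) ≤ + 10 × halfTrace (b ⊗ b) ≤ + 10
  all-three = ≤-split (ℤ.+-mono-≤ πx²≥0 πuy²≥0) b²≥0 (ℤ.≤-reflexive sum≡10)
  first-two : halfTrace (π ⊗ (x ⊗ x)) ≤ + 10 × halfTrace (π ⊗ u ⊗ (y ⊗ y)) ≤ + 10
  first-two = ≤-split πx²≥0 πuy²≥0 (proj₁ all-three)
  b²≤10 : halfTrace (𝟙 ⊗ (b ⊗ b)) ≤ + 10
  b²≤10 = subst (_≤ + 10) (sym (halfTrace-𝟙⊗ (b ⊗ b))) (proj₂ all-three)

-- The multiplier is 25/(uπ²), an element of O_K: π² is α² times a unit and 25 is α⁸ times a unit.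
uππ-cancel : ∀ {r} → u ⊗ π ⊗ π ⊗ r ≡ 𝟘 → r ≡ 𝟘
uππ-cancel {r} = non-zero-divisor {u ⊗ π ⊗ π} (ok (+ 550) (- + 475) (- + 140) (+ 125)) 24 refl {r}

-- Ternary lattices over O_K

matrix : Gram → SymmetricMatrix OK
matrix G = symmetric (g11 G) (g22 G) (g33 G) (g12 G) (g13 G) (g23 G)

vector : Vec3 → Vector OK
vector v = ⟨ x v , y v , z v ⟩

vec3 : Vector OK → Vec3
vec3 ⟨ a , b , c ⟩ = v3 a b c

Q≡‖‖ : ∀ G v → Q G (vec3 v) ≡ 𝒪.Form.‖_‖ (matrix G) v
Q≡‖‖ G v = refl

Q-𝟘₃ : ∀ G → Q G 𝟘₃ ≡ 𝟘
Q-𝟘₃ G = refl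

is-𝟘₃? : ∀ v → Dec (v ≡ 𝟘₃)
is-𝟘₃? (v3 a b c) = map′ (λ { (refl , refl , refl) → refl }) (λ { refl → refl , refl , refl })
  (a ≟ᴼ 𝟘 ×-dec b ≟ᴼ 𝟘 ×-dec c ≟ᴼ 𝟘)

norms-nonneg : ∀ G → PositiveDefinite G → ∀ v → ZeroOrTotPos (𝒪.Form.‖_‖ (matrix G) v)
norms-nonneg G positive v = ZeroOrTotPos-resp (Q≡‖‖ G v) (decide (is-𝟘₃? (vec3 v)))
  where
  decide : Dec (vec3 v ≡ 𝟘₃) → ZeroOrTotPos (Q G (vec3 v))
  decide (yes v≡0) = is-zero (trans (cong (Q G) {vec3 v} {𝟘₃} v≡0) (Q-𝟘₃ G))
  decide (no v≢0) = is-totPos (positive (vec3 v) v≢0)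

represented : ∀ G → Universal G → ∀ a → TotPos a → Σ (Vector OK) (λ v → 𝒪.Form.‖_‖ (matrix G) v ≡ a)
represented G universal a a≫0 = lift (universal a a≫0)
  where
  lift : Σ Vec3 (λ v → Q G v ≡ a) → Σ (Vector OK) (λ v → 𝒪.Form.‖_‖ (matrix G) v ≡ a)
  lift (v , Qv≡a) = vector v , trans (sym (Q≡‖‖ G (vector v))) (trans (cong (Q G) {vec3 (vector v)} {v} refl) Qv≡a)

𝟙≫0 : TotPos 𝟙
𝟙≫0 = from-yes (TotPos? 𝟙)

u≫0 : TotPos u
u≫0 = from-yes (TotPos? u)

π≫0 : TotPos π
π≫0 = from-yes (TotPos? π)

τ≫0 : TotPos τ
τ≫0 = from-yes (TotPos? τ)

proposition5p1 : ¬ Σ Gram (λ G → PositiveDefinite G × Universal G)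
proposition5p1 (G , positive , universal) =
  𝒪.Form.Obstruction.absurd (matrix G) ZeroOrTotPos ZeroOrTotPos-resp (norms-nonneg G positive)
    u u⁻¹ π τ refl uππ-cancel square-below-u squares-below-π πτ-unrepresented
    (represent 𝟙 𝟙≫0) (represent u u≫0) (represent π π≫0) (represent τ τ≫0)
  where
  represent : ∀ a → TotPos a → Σ (Vector OK) (λ v → 𝒪.Form.‖_‖ (matrix G) v ≡ a)
  represent = represented G universal
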